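{- For non-negative integer $L$ and integer $a$, \[ \sum_{i\geq 0} q^{\binom{i+1}{2}} {L\brack i}_q \left\{ T_{ -1}\left(\begin{array}{c}i\\ a \end{array};q \right) + T_{ -1}\left(\begin{array}{c}i\\ a+1 \end{array};q \right) \right\} = q^{\binom{a+1}{2}} {2L+1\brack L-a}_q. \]
   Context: Notation: $(a;q)_n=(1-a)(1-aq)\cdots(1-aq^{n-1})$ with $1/(q;q)_n=0$ for $n<0$. The $q$-binomial coefficient is ${m+n\brack m}_q=\frac{(q;q)_{m+n}}{(q;q)_m(q;q)_n}$ for $m,n\geq 0$ and $0$ otherwise. The $q$-trinomial coefficient is $\left(\begin{array}{c}L,\, b\\ a \end{array};q\right)_2 = \sum_{n\geq 0} q^{n(n+b)} \frac{(q;q)_L}{(q;q)_n(q;q)_{n+a}(q;q)_{L-2n-a}}$, and for an integer $n$, $T_n\left(\begin{array}{c}L\\ a\end{array};q\right) = q^{(L(L-n)-a(a-n))/2}\left(\begin{array}{c}L,\, a-n\\ a \end{array};1/q\right)_2$. -}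

module Defs where

open import Data.Nat as ℕ using (ℕ; zero; suc)
open import Data.Integer as ℤ using (ℤ; +_; -[1+_])
open import Data.Integer.DivMod using (_/ℕ_)
open import Data.Rational as ℚ using (ℚ; 0ℚ; 1ℚ; 1/_; ≢-nonZero)
open import Data.Rational.Properties using (_≟_)
open import Relation.Nullary using (yes; no)

-- Total inverse on ℚ (value 0 at 0; never used at 0 under the theorem's hypotheses).
inv : ℚ → ℚ
inv p with p ≟ 0ℚ
... | yes _  = 0ℚ
... | no p≢0 = 1/_ p {{≢-nonZero p≢0}}

powN : ℚ → ℕ → ℚ
powN q zero    = 1ℚ
powN q (suc n) = q ℚ.* powN q n

powZ : ℚ → ℤ → ℚ
powZ q (+ n)      = powN q n
powZ q -[1+ n ]   = inv (powN q (suc n))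

sumTo : ℕ → (ℕ → ℚ) → ℚ
sumTo zero    f = f 0
sumTo (suc n) f = sumTo n f ℚ.+ f (suc n)

poch : ℚ → ℕ → ℚ
poch q zero    = 1ℚ
poch q (suc n) = poch q n ℚ.* (1ℚ ℚ.- powN q (suc n))

pochInv : ℚ → ℤ → ℚ
pochInv q (+ n)    = inv (poch q n)
pochInv q -[1+ n ] = 0ℚ

-- q-binomial [N brack K]_q = (q;q)_N / ((q;q)_K (q;q)_{N-K}) if 0 ≤ K ≤ N, else 0
qbin : ℚ → ℤ → ℤ → ℚ
qbin q (+ N)    K = poch q N ℚ.* pochInv q K ℚ.* pochInv q (+ N ℤ.- K)
qbin q -[1+ N ] K = 0ℚ

-- q-trinomial (L, b; a ; q)_2 = Σ_{n≥0} q^{n(n+b)} (q;q)_L / ((q;q)_n (q;q)_{n+a} (q;q)_{L-2n-a}).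
-- Terms with n > L vanish (one of n+a, L-2n-a is negative), so the sum is truncated at n = L.
trinom : ℚ → ℕ → ℤ → ℤ → ℚ
trinom q L b a = sumTo L (λ n →
  powZ q (+ n ℤ.* (+ n ℤ.+ b)) ℚ.* poch q L ℚ.* pochInv q (+ n)
    ℚ.* pochInv q (+ n ℤ.+ a) ℚ.* pochInv q (+ L ℤ.- + 2 ℤ.* + n ℤ.- a))

-- T_n (L ; a ; q) = q^{(L(L-n) - a(a-n))/2} (L, a-n; a ; 1/q)_2
-- (exponent is an integer for n = -1, the only case used below)
T : ℚ → ℤ → ℕ → ℤ → ℚ
T q n L a = powZ q ((+ L ℤ.* (+ L ℤ.- n) ℤ.- a ℤ.* (a ℤ.- n)) /ℕ 2)
            ℚ.* trinom (inv q) L (a ℤ.- n) a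

{-# OPTIONS --safe #-}
-- Rewriting 1/q as q, q^{i(i+1)/2} T₋₁(i; a) becomes q^{a(a+1)/2} times the sum over n of
-- q^{n(n+a)+(i-n+1)(i-n-a)} (q;q)_i / ((q;q)_n (q;q)_{n+a} (q;q)_{i-2n-a}).
-- Substituting i = v + n, this summand times [L, i] factors as q^{(v+1)(v-a)} [L, v] times the
-- q-Chu-Vandermonde summand q^{n(n+a)} [L-v, n] [v, n+a], whose sum over n is [L, v-a].
-- So the left side is q^{a(a+1)/2} (H(a) + q^{a+1} H(a+1)) with H(a) = Σ_v q^{(v+1)(v-a)} [L, v] [L, v-a],
-- and q-Pascal merges the two sums into the single Vandermonde sum Σ_n q^{n(n-a)} [L, n] [L+1, n-a] = [2L+1, L-a].
module Submission where

open import Defs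
open import Data.Nat as ℕ using (ℕ)
open import Data.Integer as ℤ using (ℤ; +_; -1ℤ)
open import Data.Integer.DivMod using (_/ℕ_)
open import Data.Rational as ℚ using (ℚ; 0ℚ; 1ℚ)
open import Relation.Binary.PropositionalEquality using (_≡_; _≢_)

open import Data.Nat using (zero; suc; _≤_; z≤n; s≤s)
open import Data.Integer using (-[1+_])
open import Data.Integer.DivMod using (_%ℕ_; a≡a%ℕn+[a/ℕn]*n; n%ℕd<d)
open import Data.Integer.Tactic.RingSolver using (solve-∀)
open import Data.Rational.Solver using (module +-*-Solver)
import Data.Nat.Properties as ℕP
import Data.Integer.Properties as ℤP
import Data.Rational.Properties as ℚP
open import Data.Empty using (⊥-elim)
open import Data.Sum using (inj₁; inj₂)
open import Function.Base using (_∘_)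
open import Relation.Binary.Definitions using (tri<; tri≈; tri>)
open import Relation.Binary.PropositionalEquality
  using (refl; sym; trans; cong; cong₂; subst; module ≡-Reasoning)
open import Relation.Nullary using (yes; no)

open +-*-Solver
open ≡-Reasoning

inv-inverseˡ : ∀ p → p ≢ 0ℚ → inv p ℚ.* p ≡ 1ℚ
inv-inverseˡ p p≢0 with p ℚP.≟ 0ℚ
... | yes p≡0  = ⊥-elim (p≢0 p≡0)
... | no  p≢0′ = ℚP.*-inverseˡ p {{ℚ.≢-nonZero p≢0′}}

inv-inverseʳ : ∀ p → p ≢ 0ℚ → p ℚ.* inv p ≡ 1ℚ
inv-inverseʳ p p≢0 = trans (ℚP.*-comm p (inv p)) (inv-inverseˡ p p≢0)

inv-unique : ∀ p z → p ≢ 0ℚ → z ℚ.* p ≡ 1ℚ → z ≡ inv p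
inv-unique p z p≢0 zp≡1 = begin
  z                    ≡⟨ sym (ℚP.*-identityʳ z) ⟩
  z ℚ.* 1ℚ             ≡⟨ cong (z ℚ.*_) (sym (inv-inverseʳ p p≢0)) ⟩
  z ℚ.* (p ℚ.* inv p)  ≡⟨ sym (ℚP.*-assoc z p (inv p)) ⟩
  z ℚ.* p ℚ.* inv p    ≡⟨ cong (ℚ._* inv p) zp≡1 ⟩
  1ℚ ℚ.* inv p         ≡⟨ ℚP.*-identityˡ (inv p) ⟩
  inv p                ∎

*-≢0 : ∀ {x y} → x ≢ 0ℚ → y ≢ 0ℚ → x ℚ.* y ≢ 0ℚ
*-≢0 {x} {y} x≢0 y≢0 xy≡0 = y≢0 (begin
  y                    ≡⟨ sym (ℚP.*-identityˡ y) ⟩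
  1ℚ ℚ.* y             ≡⟨ cong (ℚ._* y) (sym (inv-inverseˡ x x≢0)) ⟩
  inv x ℚ.* x ℚ.* y    ≡⟨ ℚP.*-assoc (inv x) x y ⟩
  inv x ℚ.* (x ℚ.* y)  ≡⟨ cong (inv x ℚ.*_) xy≡0 ⟩
  inv x ℚ.* 0ℚ         ≡⟨ ℚP.*-zeroʳ (inv x) ⟩
  0ℚ                   ∎)

inv-≢0 : ∀ {x} → x ≢ 0ℚ → inv x ≢ 0ℚ
inv-≢0 {x} x≢0 inv≡0 = ℚP.1≢0 (begin
  1ℚ           ≡⟨ sym (inv-inverseˡ x x≢0) ⟩
  inv x ℚ.* x  ≡⟨ cong (ℚ._* x) inv≡0 ⟩
  0ℚ ℚ.* x     ≡⟨ ℚP.*-zeroˡ x ⟩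
  0ℚ           ∎)

inv-distrib-* : ∀ x y → x ≢ 0ℚ → y ≢ 0ℚ → inv (x ℚ.* y) ≡ inv x ℚ.* inv y
inv-distrib-* x y x≢0 y≢0 = sym (inv-unique (x ℚ.* y) (inv x ℚ.* inv y) (*-≢0 x≢0 y≢0) (begin
  inv x ℚ.* inv y ℚ.* (x ℚ.* y)      ≡⟨ solve 4 (λ a b c d → a :* b :* (c :* d) := a :* c :* (b :* d)) refl (inv x) (inv y) x y ⟩
  inv x ℚ.* x ℚ.* (inv y ℚ.* y)      ≡⟨ cong₂ ℚ._*_ (inv-inverseˡ x x≢0) (inv-inverseˡ y y≢0) ⟩
  1ℚ                                 ∎))

inv-involutive : ∀ x → x ≢ 0ℚ → inv (inv x) ≡ x
inv-involutive x x≢0 = sym (inv-unique (inv x) x (inv-≢0 x≢0) (inv-inverseʳ x x≢0))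

inv-1 : inv 1ℚ ≡ 1ℚ
inv-1 = sym (inv-unique 1ℚ 1ℚ (λ ()) refl)

powN-+ : ∀ r m n → powN r (m ℕ.+ n) ≡ powN r m ℚ.* powN r n
powN-+ r zero    n = sym (ℚP.*-identityˡ _)
powN-+ r (suc m) n = trans (cong (r ℚ.*_) (powN-+ r m n)) (sym (ℚP.*-assoc r _ _))

powN-≢0 : ∀ {r} → r ≢ 0ℚ → ∀ n → powN r n ≢ 0ℚ
powN-≢0 r≢0 zero    = λ ()
powN-≢0 r≢0 (suc n) = *-≢0 r≢0 (powN-≢0 r≢0 n)

powN-inv : ∀ {r} → r ≢ 0ℚ → ∀ n → powN (inv r) n ≡ inv (powN r n)
powN-inv r≢0 zero    = sym inv-1
powN-inv {r} r≢0 (suc n) = trans (cong (inv r ℚ.*_) (powN-inv r≢0 n))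
                                 (sym (inv-distrib-* r _ r≢0 (powN-≢0 r≢0 n)))

powN-neg1-double : ∀ n → powN (ℚ.- 1ℚ) (n ℕ.+ n) ≡ 1ℚ
powN-neg1-double zero    = refl
powN-neg1-double (suc n) = begin
  ℚ.- 1ℚ ℚ.* powN (ℚ.- 1ℚ) (n ℕ.+ suc n)           ≡⟨ cong (λ k → ℚ.- 1ℚ ℚ.* powN (ℚ.- 1ℚ) k) (ℕP.+-suc n n) ⟩
  ℚ.- 1ℚ ℚ.* (ℚ.- 1ℚ ℚ.* powN (ℚ.- 1ℚ) (n ℕ.+ n))  ≡⟨ solve 1 (λ x → :- con 1ℚ :* (:- con 1ℚ :* x) := x) refl _ ⟩
  powN (ℚ.- 1ℚ) (n ℕ.+ n)                          ≡⟨ powN-neg1-double n ⟩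
  1ℚ                                               ∎

module _ {r : ℚ} (r≢0 : r ≢ 0ℚ) where

  powZ-≢0 : ∀ z → powZ r z ≢ 0ℚ
  powZ-≢0 (+ n)    = powN-≢0 r≢0 n
  powZ-≢0 -[1+ n ] = inv-≢0 (powN-≢0 r≢0 (suc n))

  powZ-suc : ∀ z → powZ r (z ℤ.+ + 1) ≡ powZ r z ℚ.* r
  powZ-suc (+ n)          = trans (cong (powN r) (ℕP.+-comm n 1)) (ℚP.*-comm r _)
  powZ-suc -[1+ zero ]    = sym (trans (cong (λ x → inv x ℚ.* r) (ℚP.*-identityʳ r)) (inv-inverseˡ r r≢0))
  powZ-suc -[1+ suc n ]   = sym (begin
    inv (r ℚ.* rⁿ⁺¹) ℚ.* r         ≡⟨ cong (ℚ._* r) (inv-distrib-* r rⁿ⁺¹ r≢0 (powN-≢0 r≢0 (suc n))) ⟩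
    inv r ℚ.* inv rⁿ⁺¹ ℚ.* r       ≡⟨ solve 3 (λ a b c → a :* b :* c := a :* c :* b) refl (inv r) (inv rⁿ⁺¹) r ⟩
    inv r ℚ.* r ℚ.* inv rⁿ⁺¹       ≡⟨ cong (ℚ._* inv rⁿ⁺¹) (inv-inverseˡ r r≢0) ⟩
    1ℚ ℚ.* inv rⁿ⁺¹                ≡⟨ ℚP.*-identityˡ _ ⟩
    inv rⁿ⁺¹                       ∎)
    where rⁿ⁺¹ = powN r (suc n)

  powZ-pred : ∀ z → powZ r (z ℤ.- + 1) ≡ powZ r z ℚ.* inv r
  powZ-pred z = begin
    powZ r w                        ≡⟨ sym (ℚP.*-identityʳ _) ⟩
    powZ r w ℚ.* 1ℚ                 ≡⟨ cong (powZ r w ℚ.*_) (sym (inv-inverseʳ r r≢0)) ⟩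
    powZ r w ℚ.* (r ℚ.* inv r)      ≡⟨ sym (ℚP.*-assoc (powZ r w) r (inv r)) ⟩
    powZ r w ℚ.* r ℚ.* inv r        ≡⟨ cong (ℚ._* inv r) (sym (powZ-suc w)) ⟩
    powZ r (w ℤ.+ + 1) ℚ.* inv r    ≡⟨ cong (λ x → powZ r x ℚ.* inv r) (pred-suc z) ⟩
    powZ r z ℚ.* inv r              ∎
    where
    w = z ℤ.- + 1
    pred-suc : ∀ z → z ℤ.- + 1 ℤ.+ + 1 ≡ z
    pred-suc = solve-∀

  powZ-+ : ∀ x y → powZ r (x ℤ.+ y) ≡ powZ r x ℚ.* powZ r y
  powZ-+ x (+ zero)       = trans (cong (powZ r) (ℤP.+-identityʳ x)) (sym (ℚP.*-identityʳ _))
  powZ-+ x (+ suc n)      = begin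
    powZ r (x ℤ.+ + suc n)            ≡⟨ cong (λ k → powZ r (x ℤ.+ + k)) (ℕP.+-comm 1 n) ⟩
    powZ r (x ℤ.+ (+ n ℤ.+ + 1))      ≡⟨ cong (powZ r) (sym (ℤP.+-assoc x (+ n) (+ 1))) ⟩
    powZ r (x ℤ.+ + n ℤ.+ + 1)        ≡⟨ powZ-suc (x ℤ.+ + n) ⟩
    powZ r (x ℤ.+ + n) ℚ.* r          ≡⟨ cong (ℚ._* r) (powZ-+ x (+ n)) ⟩
    powZ r x ℚ.* powN r n ℚ.* r       ≡⟨ solve 3 (λ a b c → a :* b :* c := a :* (c :* b)) refl (powZ r x) (powN r n) r ⟩
    powZ r x ℚ.* (r ℚ.* powN r n)     ∎
  powZ-+ x -[1+ zero ]    = begin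
    powZ r (x ℤ.- + 1)                ≡⟨ powZ-pred x ⟩
    powZ r x ℚ.* inv r                ≡⟨ cong (λ w → powZ r x ℚ.* inv w) (sym (ℚP.*-identityʳ r)) ⟩
    powZ r x ℚ.* inv (r ℚ.* 1ℚ)       ∎
  powZ-+ x -[1+ suc n ]   = begin
    powZ r (x ℤ.+ -[1+ suc n ])               ≡⟨ cong (powZ r) (sym (trans (ℤP.+-assoc x -[1+ n ] (ℤ.- + 1))
                                                   (cong (λ k → x ℤ.+ -[1+ suc k ]) (ℕP.+-identityʳ n)))) ⟩
    powZ r (x ℤ.+ -[1+ n ] ℤ.- + 1)           ≡⟨ powZ-pred (x ℤ.+ -[1+ n ]) ⟩
    powZ r (x ℤ.+ -[1+ n ]) ℚ.* inv r         ≡⟨ cong (ℚ._* inv r) (powZ-+ x -[1+ n ]) ⟩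
    powZ r x ℚ.* inv rⁿ⁺¹ ℚ.* inv r           ≡⟨ solve 3 (λ a b c → a :* b :* c := a :* (c :* b)) refl (powZ r x) (inv rⁿ⁺¹) (inv r) ⟩
    powZ r x ℚ.* (inv r ℚ.* inv rⁿ⁺¹)         ≡⟨ cong (powZ r x ℚ.*_) (sym (inv-distrib-* r rⁿ⁺¹ r≢0 (powN-≢0 r≢0 (suc n)))) ⟩
    powZ r x ℚ.* inv (r ℚ.* rⁿ⁺¹)             ∎
    where rⁿ⁺¹ = powN r (suc n)

sign : ℤ → ℚ
sign = powZ (ℚ.- 1ℚ)

-1≢0 : ℚ.- 1ℚ ≢ 0ℚ
-1≢0 ()

sign-square : ∀ x → sign x ℚ.* sign x ≡ 1ℚ
sign-square (+ m)    = trans (sym (powZ-+ -1≢0 (+ m) (+ m))) (powN-neg1-double m)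
sign-square -[1+ m ] = begin
  inv s ℚ.* inv s  ≡⟨ sym (inv-distrib-* s s (powZ-≢0 -1≢0 (+ suc m)) (powZ-≢0 -1≢0 (+ suc m))) ⟩
  inv (s ℚ.* s)    ≡⟨ cong inv (sign-square (+ suc m)) ⟩
  inv 1ℚ           ≡⟨ inv-1 ⟩
  1ℚ               ∎
  where s = sign (+ suc m)

sign-trinomial : ∀ i n a → sign (+ i) ℚ.* sign n ℚ.* sign (n ℤ.+ a) ℚ.* sign (+ i ℤ.- + 2 ℤ.* n ℤ.- a) ≡ 1ℚ
sign-trinomial i n a = begin
  sign (+ i) ℚ.* sign n ℚ.* sign (n ℤ.+ a) ℚ.* sign k
    ≡⟨ cong (λ x → x ℚ.* sign (n ℤ.+ a) ℚ.* sign k) (sym (powZ-+ -1≢0 (+ i) n)) ⟩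
  sign (+ i ℤ.+ n) ℚ.* sign (n ℤ.+ a) ℚ.* sign k
    ≡⟨ cong (ℚ._* sign k) (sym (powZ-+ -1≢0 (+ i ℤ.+ n) (n ℤ.+ a))) ⟩
  sign (+ i ℤ.+ n ℤ.+ (n ℤ.+ a)) ℚ.* sign k
    ≡⟨ sym (powZ-+ -1≢0 (+ i ℤ.+ n ℤ.+ (n ℤ.+ a)) k) ⟩
  sign (+ i ℤ.+ n ℤ.+ (n ℤ.+ a) ℤ.+ k)
    ≡⟨ cong sign (index-sum (+ i) n a) ⟩
  sign (+ i ℤ.+ + i)
    ≡⟨ powN-neg1-double i ⟩
  1ℚ ∎
  where
  k = + i ℤ.- + 2 ℤ.* n ℤ.- a
  index-sum : ∀ i n a → i ℤ.+ n ℤ.+ (n ℤ.+ a) ℤ.+ (i ℤ.- + 2 ℤ.* n ℤ.- a) ≡ i ℤ.+ i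
  index-sum = solve-∀

∣powN∣ : ∀ q n → ℚ.∣ powN q n ∣ ≡ powN ℚ.∣ q ∣ n
∣powN∣ q zero    = refl
∣powN∣ q (suc n) = trans (ℚP.∣p*q∣≡∣p∣*∣q∣ q (powN q n)) (cong (ℚ.∣ q ∣ ℚ.*_) (∣powN∣ q n))

module _ {s : ℚ} (s≥0 : ℚ.NonNegative s) where

  s≤powN-suc : ∀ n → 1ℚ ℚ.≤ powN s n → s ℚ.≤ powN s (suc n)
  s≤powN-suc n h = ℚP.≤-trans (ℚP.≤-reflexive (sym (ℚP.*-identityʳ s))) (ℚP.*-monoˡ-≤-nonNeg s {{s≥0}} h)

  powN-suc≤s : ∀ n → powN s n ℚ.≤ 1ℚ → powN s (suc n) ℚ.≤ s
  powN-suc≤s n h = ℚP.≤-trans (ℚP.*-monoˡ-≤-nonNeg s {{s≥0}} h) (ℚP.≤-reflexive (ℚP.*-identityʳ s))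

  1≤powN : 1ℚ ℚ.< s → ∀ n → 1ℚ ℚ.≤ powN s n
  1≤powN 1<s zero    = ℚP.≤-refl
  1≤powN 1<s (suc n) = ℚP.≤-trans (ℚP.<⇒≤ 1<s) (s≤powN-suc n (1≤powN 1<s n))

  powN≤1 : s ℚ.< 1ℚ → ∀ n → powN s n ℚ.≤ 1ℚ
  powN≤1 s<1 zero    = ℚP.≤-refl
  powN≤1 s<1 (suc n) = ℚP.≤-trans (powN-suc≤s n (powN≤1 s<1 n)) (ℚP.<⇒≤ s<1)

  nonNeg-powN-suc≢1 : s ≢ 1ℚ → ∀ n → powN s (suc n) ≢ 1ℚ
  nonNeg-powN-suc≢1 s≢1 n sⁿ⁺¹≡1 with ℚP.<-cmp s 1ℚ
  ... | tri< s<1 _ _ = ℚP.<-irrefl sⁿ⁺¹≡1 (ℚP.≤-<-trans (powN-suc≤s n (powN≤1 s<1 n)) s<1)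
  ... | tri≈ _ s≡1 _ = s≢1 s≡1
  ... | tri> _ _ 1<s = ℚP.<-irrefl (sym sⁿ⁺¹≡1) (ℚP.<-≤-trans 1<s (s≤powN-suc n (1≤powN 1<s n)))

∣q∣≢1 : ∀ {q} → q ≢ 1ℚ → q ≢ ℚ.- 1ℚ → ℚ.∣ q ∣ ≢ 1ℚ
∣q∣≢1 {q} q≢1 q≢-1 ∣q∣≡1 with ℚP.∣p∣≡p∨∣p∣≡-p q
... | inj₁ ∣q∣≡q  = q≢1 (trans (sym ∣q∣≡q) ∣q∣≡1)
... | inj₂ ∣q∣≡-q = q≢-1 (ℚP.neg-injective (trans (sym ∣q∣≡-q) ∣q∣≡1))

powN-suc≢1 : ∀ {q} → q ≢ 1ℚ → q ≢ ℚ.- 1ℚ → ∀ n → powN q (suc n) ≢ 1ℚ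
powN-suc≢1 {q} q≢1 q≢-1 n qⁿ⁺¹≡1 =
  nonNeg-powN-suc≢1 (ℚP.∣-∣-nonNeg q) (∣q∣≢1 q≢1 q≢-1) n (trans (sym (∣powN∣ q (suc n))) (cong ℚ.∣_∣ qⁿ⁺¹≡1))

1-powN-suc≢0 : ∀ {q} → q ≢ 1ℚ → q ≢ ℚ.- 1ℚ → ∀ n → 1ℚ ℚ.- powN q (suc n) ≢ 0ℚ
1-powN-suc≢0 {q} q≢1 q≢-1 n diff≡0 = powN-suc≢1 q≢1 q≢-1 n (sym (begin
  1ℚ                              ≡⟨ solve 1 (λ x → con 1ℚ := con 1ℚ :- x :+ x) refl (powN q (suc n)) ⟩
  1ℚ ℚ.- powN q (suc n) ℚ.+ powN q (suc n)  ≡⟨ cong (ℚ._+ powN q (suc n)) diff≡0 ⟩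
  0ℚ ℚ.+ powN q (suc n)           ≡⟨ ℚP.+-identityˡ _ ⟩
  powN q (suc n)                  ∎))

poch-≢0 : ∀ {q} → q ≢ 1ℚ → q ≢ ℚ.- 1ℚ → ∀ n → poch q n ≢ 0ℚ
poch-≢0 q≢1 q≢-1 zero    = λ ()
poch-≢0 q≢1 q≢-1 (suc n) = *-≢0 (poch-≢0 q≢1 q≢-1 n) (1-powN-suc≢0 q≢1 q≢-1 n)

*2/ℕ2 : ∀ t → (t ℤ.* + 2) /ℕ 2 ≡ t
*2/ℕ2 t with (t ℤ.* + 2) %ℕ 2 | a≡a%ℕn+[a/ℕn]*n (t ℤ.* + 2) 2 | n%ℕd<d (t ℤ.* + 2) 2
... | zero        | 2t≡2h   | _ = sym (ℤP.*-cancelʳ-≡ t _ (+ 2) (trans 2t≡2h (ℤP.+-identityˡ _)))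
... | suc zero    | 2t≡1+2h | _ = ⊥-elim (2*≢1 (t ℤ.- h) (begin
      (t ℤ.- h) ℤ.* + 2              ≡⟨ distrib t h ⟩
      t ℤ.* + 2 ℤ.- h ℤ.* + 2        ≡⟨ cong (ℤ._- h ℤ.* + 2) 2t≡1+2h ⟩
      + 1 ℤ.+ h ℤ.* + 2 ℤ.- h ℤ.* + 2  ≡⟨ cancel h ⟩
      + 1                            ∎))
  where
  h = (t ℤ.* + 2) /ℕ 2
  2*≢1 : ∀ k → k ℤ.* + 2 ≢ + 1
  2*≢1 (+ zero)  ()
  2*≢1 (+ suc m) ()
  2*≢1 -[1+ m ]  ()
  distrib : ∀ t h → (t ℤ.- h) ℤ.* + 2 ≡ t ℤ.* + 2 ℤ.- h ℤ.* + 2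
  distrib = solve-∀
  cancel : ∀ h → + 1 ℤ.+ h ℤ.* + 2 ℤ.- h ℤ.* + 2 ≡ + 1
  cancel = solve-∀
... | suc (suc _) | _ | s≤s (s≤s ())

triangleℕ : ℕ → ℕ
triangleℕ zero    = 0
triangleℕ (suc n) = suc n ℕ.+ triangleℕ n

-- x(x+1)/2, extended to negative x by the symmetry x ↦ -1-x.
triangle : ℤ → ℤ
triangle (+ n)    = + triangleℕ n
triangle -[1+ n ] = + triangleℕ n

triangleℕ-*2 : ∀ n → + triangleℕ n ℤ.* + 2 ≡ + n ℤ.* (+ n ℤ.+ + 1)
triangleℕ-*2 zero    = refl
triangleℕ-*2 (suc n) = begin
  + (suc n ℕ.+ triangleℕ n) ℤ.* + 2                  ≡⟨ cong (ℤ._* + 2) (ℤP.pos-+ (suc n) (triangleℕ n)) ⟩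
  (+ 1 ℤ.+ + n ℤ.+ + triangleℕ n) ℤ.* + 2            ≡⟨ distrib (+ 1 ℤ.+ + n) (+ triangleℕ n) ⟩
  (+ 1 ℤ.+ + n) ℤ.* + 2 ℤ.+ + triangleℕ n ℤ.* + 2    ≡⟨ cong (λ t → (+ 1 ℤ.+ + n) ℤ.* + 2 ℤ.+ t) (triangleℕ-*2 n) ⟩
  (+ 1 ℤ.+ + n) ℤ.* + 2 ℤ.+ + n ℤ.* (+ n ℤ.+ + 1)    ≡⟨ step (+ n) ⟩
  (+ 1 ℤ.+ + n) ℤ.* (+ 1 ℤ.+ + n ℤ.+ + 1)            ∎
  where
  distrib : ∀ m t → (m ℤ.+ t) ℤ.* + 2 ≡ m ℤ.* + 2 ℤ.+ t ℤ.* + 2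
  distrib = solve-∀
  step : ∀ n → (+ 1 ℤ.+ n) ℤ.* + 2 ℤ.+ n ℤ.* (n ℤ.+ + 1) ≡ (+ 1 ℤ.+ n) ℤ.* (+ 1 ℤ.+ n ℤ.+ + 1)
  step = solve-∀

triangle-*2 : ∀ x → triangle x ℤ.* + 2 ≡ x ℤ.* (x ℤ.+ + 1)
triangle-*2 (+ n)    = triangleℕ-*2 n
triangle-*2 -[1+ n ] = trans (triangleℕ-*2 n) (reflect (+ n))
  where
  reflect : ∀ n → n ℤ.* (n ℤ.+ + 1) ≡ (ℤ.- (+ 1 ℤ.+ n)) ℤ.* (ℤ.- (+ 1 ℤ.+ n) ℤ.+ + 1)
  reflect = solve-∀

triangle-/ℕ2 : ∀ x → (x ℤ.* (x ℤ.+ + 1)) /ℕ 2 ≡ triangle x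
triangle-/ℕ2 x = trans (cong (_/ℕ 2) (sym (triangle-*2 x))) (*2/ℕ2 (triangle x))

*2-injective : ∀ x y → x ℤ.* + 2 ≡ y ℤ.* + 2 → x ≡ y
*2-injective x y = ℤP.*-cancelʳ-≡ x y (+ 2)

k-[1+a]≡0⇒k≡1+a : ∀ k a → + k ℤ.+ -[1+ a ] ≡ + 0 → k ≡ suc a
k-[1+a]≡0⇒k≡1+a k a k-[1+a]≡0 = ℤP.+-injective (trans (x≡x-y+y (+ k) (+ suc a)) (cong (ℤ._+ + suc a) k-[1+a]≡0))
  where
  x≡x-y+y : ∀ x y → x ≡ x ℤ.- y ℤ.+ y
  x≡x-y+y = solve-∀

triangle-suc : ∀ a → triangle (a ℤ.+ + 1) ≡ triangle a ℤ.+ (a ℤ.+ + 1)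
triangle-suc a = *2-injective _ _ (begin
  triangle (a ℤ.+ + 1) ℤ.* + 2               ≡⟨ triangle-*2 (a ℤ.+ + 1) ⟩
  (a ℤ.+ + 1) ℤ.* (a ℤ.+ + 1 ℤ.+ + 1)        ≡⟨ split a ⟩
  a ℤ.* (a ℤ.+ + 1) ℤ.+ (a ℤ.+ + 1) ℤ.* + 2  ≡⟨ cong (ℤ._+ (a ℤ.+ + 1) ℤ.* + 2) (sym (triangle-*2 a)) ⟩
  triangle a ℤ.* + 2 ℤ.+ (a ℤ.+ + 1) ℤ.* + 2 ≡⟨ sym (ℤP.*-distribʳ-+ (+ 2) (triangle a) (a ℤ.+ + 1)) ⟩
  (triangle a ℤ.+ (a ℤ.+ + 1)) ℤ.* + 2       ∎)
  where
  split : ∀ a → (a ℤ.+ + 1) ℤ.* (a ℤ.+ + 1 ℤ.+ + 1) ≡ a ℤ.* (a ℤ.+ + 1) ℤ.+ (a ℤ.+ + 1) ℤ.* + 2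
  split = solve-∀

triangle-difference : ∀ x a → (x ℤ.* (x ℤ.- -1ℤ) ℤ.- a ℤ.* (a ℤ.- -1ℤ)) /ℕ 2 ≡ triangle x ℤ.- triangle a
triangle-difference x a = trans (cong (_/ℕ 2) doubled) (*2/ℕ2 (triangle x ℤ.- triangle a))
  where
  distrib : ∀ s t → s ℤ.* + 2 ℤ.- t ℤ.* + 2 ≡ (s ℤ.- t) ℤ.* + 2
  distrib = solve-∀
  doubled : x ℤ.* (x ℤ.- -1ℤ) ℤ.- a ℤ.* (a ℤ.- -1ℤ) ≡ (triangle x ℤ.- triangle a) ℤ.* + 2
  doubled = trans (cong₂ ℤ._-_ (sym (triangle-*2 x)) (sym (triangle-*2 a))) (distrib (triangle x) (triangle a))

trinomial-exponent : ∀ i n a →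
  triangle i ℤ.+ (triangle i ℤ.- triangle a) ℤ.+ ℤ.- (n ℤ.* (n ℤ.+ (a ℤ.+ + 1))) ℤ.+ ℤ.- triangle i
    ℤ.+ triangle n ℤ.+ triangle (n ℤ.+ a) ℤ.+ triangle (i ℤ.- + 2 ℤ.* n ℤ.- a)
  ≡ triangle a ℤ.+ (n ℤ.* (n ℤ.+ a) ℤ.+ (i ℤ.- n ℤ.+ + 1) ℤ.* (i ℤ.- n ℤ.- a))
trinomial-exponent i n a = *2-injective _ _ (begin
  (tᵢ ℤ.+ (tᵢ ℤ.- tₐ) ℤ.+ ℤ.- c ℤ.+ ℤ.- tᵢ ℤ.+ tₙ ℤ.+ tₙₐ ℤ.+ tₖ) ℤ.* + 2
    ≡⟨ expand tᵢ tₐ c tₙ tₙₐ tₖ ⟩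
  tᵢ ℤ.* + 2 ℤ.- tₐ ℤ.* + 2 ℤ.- c ℤ.* + 2 ℤ.+ tₙ ℤ.* + 2 ℤ.+ tₙₐ ℤ.* + 2 ℤ.+ tₖ ℤ.* + 2
    ≡⟨ cong₂ ℤ._+_ (cong₂ ℤ._+_ (cong₂ ℤ._+_ (cong₂ (λ x y → x ℤ.- y ℤ.- c ℤ.* + 2)
         (triangle-*2 i) (triangle-*2 a)) (triangle-*2 n)) (triangle-*2 (n ℤ.+ a))) (triangle-*2 k) ⟩
  i ℤ.* (i ℤ.+ + 1) ℤ.- a ℤ.* (a ℤ.+ + 1) ℤ.- c ℤ.* + 2 ℤ.+ n ℤ.* (n ℤ.+ + 1)
    ℤ.+ (n ℤ.+ a) ℤ.* (n ℤ.+ a ℤ.+ + 1) ℤ.+ k ℤ.* (k ℤ.+ + 1)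
    ≡⟨ polynomial i n a ⟩
  a ℤ.* (a ℤ.+ + 1) ℤ.+ e ℤ.* + 2
    ≡⟨ cong (ℤ._+ e ℤ.* + 2) (sym (triangle-*2 a)) ⟩
  tₐ ℤ.* + 2 ℤ.+ e ℤ.* + 2
    ≡⟨ sym (ℤP.*-distribʳ-+ (+ 2) tₐ e) ⟩
  (tₐ ℤ.+ e) ℤ.* + 2 ∎)
  where
  k = i ℤ.- + 2 ℤ.* n ℤ.- a
  c = n ℤ.* (n ℤ.+ (a ℤ.+ + 1))
  e = n ℤ.* (n ℤ.+ a) ℤ.+ (i ℤ.- n ℤ.+ + 1) ℤ.* (i ℤ.- n ℤ.- a)
  tᵢ = triangle i
  tₐ = triangle a
  tₙ = triangle n
  tₙₐ = triangle (n ℤ.+ a)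
  tₖ = triangle k
  expand : ∀ tᵢ tₐ c tₙ tₙₐ tₖ → (tᵢ ℤ.+ (tᵢ ℤ.- tₐ) ℤ.+ ℤ.- c ℤ.+ ℤ.- tᵢ ℤ.+ tₙ ℤ.+ tₙₐ ℤ.+ tₖ) ℤ.* + 2
    ≡ tᵢ ℤ.* + 2 ℤ.- tₐ ℤ.* + 2 ℤ.- c ℤ.* + 2 ℤ.+ tₙ ℤ.* + 2 ℤ.+ tₙₐ ℤ.* + 2 ℤ.+ tₖ ℤ.* + 2
  expand = solve-∀
  polynomial : ∀ i n a →
    i ℤ.* (i ℤ.+ + 1) ℤ.- a ℤ.* (a ℤ.+ + 1) ℤ.- n ℤ.* (n ℤ.+ (a ℤ.+ + 1)) ℤ.* + 2 ℤ.+ n ℤ.* (n ℤ.+ + 1)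
      ℤ.+ (n ℤ.+ a) ℤ.* (n ℤ.+ a ℤ.+ + 1) ℤ.+ (i ℤ.- + 2 ℤ.* n ℤ.- a) ℤ.* (i ℤ.- + 2 ℤ.* n ℤ.- a ℤ.+ + 1)
    ≡ a ℤ.* (a ℤ.+ + 1) ℤ.+ (n ℤ.* (n ℤ.+ a) ℤ.+ (i ℤ.- n ℤ.+ + 1) ℤ.* (i ℤ.- n ℤ.- a)) ℤ.* + 2
  polynomial = solve-∀

sumTo-cong : ∀ n {f g : ℕ → ℚ} → (∀ k → f k ≡ g k) → sumTo n f ≡ sumTo n g
sumTo-cong zero    f≗g = f≗g 0
sumTo-cong (suc n) f≗g = cong₂ ℚ._+_ (sumTo-cong n f≗g) (f≗g (suc n))

sumTo-cong-≤ : ∀ n {f g : ℕ → ℚ} → (∀ k → k ≤ n → f k ≡ g k) → sumTo n f ≡ sumTo n g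
sumTo-cong-≤ zero    f≗g = f≗g 0 z≤n
sumTo-cong-≤ (suc n) f≗g =
  cong₂ ℚ._+_ (sumTo-cong-≤ n (λ k k≤n → f≗g k (ℕP.m≤n⇒m≤1+n k≤n))) (f≗g (suc n) ℕP.≤-refl)

sumTo-distrib-+ : ∀ n (f g : ℕ → ℚ) → sumTo n (λ k → f k ℚ.+ g k) ≡ sumTo n f ℚ.+ sumTo n g
sumTo-distrib-+ zero    f g = refl
sumTo-distrib-+ (suc n) f g = trans (cong (ℚ._+ (f (suc n) ℚ.+ g (suc n))) (sumTo-distrib-+ n f g))
  (solve 4 (λ a b c d → a :+ b :+ (c :+ d) := a :+ c :+ (b :+ d)) refl (sumTo n f) (sumTo n g) (f (suc n)) (g (suc n)))

sumTo-*ˡ : ∀ n c (f : ℕ → ℚ) → sumTo n (λ k → c ℚ.* f k) ≡ c ℚ.* sumTo n f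
sumTo-*ˡ zero    c f = refl
sumTo-*ˡ (suc n) c f =
  trans (cong (ℚ._+ c ℚ.* f (suc n)) (sumTo-*ˡ n c f)) (sym (ℚP.*-distribˡ-+ c (sumTo n f) (f (suc n))))

sumTo-zero : ∀ n (f : ℕ → ℚ) → (∀ k → k ≤ n → f k ≡ 0ℚ) → sumTo n f ≡ 0ℚ
sumTo-zero n f f≡0 = trans (sumTo-cong-≤ n f≡0) (sumTo-const-0 n)
  where
  sumTo-const-0 : ∀ n → sumTo n (λ _ → 0ℚ) ≡ 0ℚ
  sumTo-const-0 zero    = refl
  sumTo-const-0 (suc n) = cong (ℚ._+ 0ℚ) (sumTo-const-0 n)

sumTo-head : ∀ n (f : ℕ → ℚ) → sumTo (suc n) f ≡ f 0 ℚ.+ sumTo n (f ∘ suc)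
sumTo-head zero    f = refl
sumTo-head (suc n) f = trans (cong (ℚ._+ f (suc (suc n))) (sumTo-head n f)) (ℚP.+-assoc (f 0) _ _)

sumTo-single : ∀ n j (f : ℕ → ℚ) → j ≤ n → (∀ k → k ≢ j → f k ≡ 0ℚ) → sumTo n f ≡ f j
sumTo-single zero    .zero   f z≤n       _   = refl
sumTo-single (suc n) zero    f _         f≡0 = begin
  sumTo (suc n) f            ≡⟨ sumTo-head n f ⟩
  f 0 ℚ.+ sumTo n (f ∘ suc)  ≡⟨ cong (f 0 ℚ.+_) (sumTo-zero n (f ∘ suc) (λ k _ → f≡0 (suc k) (λ ()))) ⟩
  f 0 ℚ.+ 0ℚ                 ≡⟨ ℚP.+-identityʳ (f 0) ⟩
  f 0                        ∎
sumTo-single (suc n) (suc j) f (s≤s j≤n) f≡0 = begin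
  sumTo (suc n) f            ≡⟨ sumTo-head n f ⟩
  f 0 ℚ.+ sumTo n (f ∘ suc)  ≡⟨ cong₂ ℚ._+_ (f≡0 0 (λ ()))
                                  (sumTo-single n j (f ∘ suc) j≤n (λ k k≢j → f≡0 (suc k) (k≢j ∘ ℕP.suc-injective))) ⟩
  0ℚ ℚ.+ f (suc j)           ≡⟨ ℚP.+-identityˡ _ ⟩
  f (suc j)                  ∎

sumTo-reverse : ∀ n (f : ℕ → ℚ) → sumTo n (λ k → f (n ℕ.∸ k)) ≡ sumTo n f
sumTo-reverse zero    f = refl
sumTo-reverse (suc n) f = begin
  sumTo (suc n) (λ k → f (suc n ℕ.∸ k))     ≡⟨ sumTo-head n (λ k → f (suc n ℕ.∸ k)) ⟩
  f (suc n) ℚ.+ sumTo n (λ k → f (n ℕ.∸ k)) ≡⟨ cong (f (suc n) ℚ.+_) (sumTo-reverse n f) ⟩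
  f (suc n) ℚ.+ sumTo n f                   ≡⟨ ℚP.+-comm (f (suc n)) (sumTo n f) ⟩
  sumTo n f ℚ.+ f (suc n)                   ∎

sumTo-triangle-swap : ∀ L (h : ℕ → ℕ → ℚ) →
  sumTo L (λ i → sumTo i (h i)) ≡ sumTo L (λ v → sumTo (L ℕ.∸ v) (λ n → h (v ℕ.+ n) n))
sumTo-triangle-swap zero    h = refl
sumTo-triangle-swap (suc L) h = begin
  sumTo L (λ i → sumTo i (h i)) ℚ.+ sumTo (suc L) (h (suc L))
    ≡⟨ cong₂ ℚ._+_ (sumTo-triangle-swap L h) (sumTo-head L (h (suc L))) ⟩
  R ℚ.+ (h (suc L) 0 ℚ.+ sumTo L (λ m → h (suc L) (suc m)))
    ≡⟨ cong (λ s → R ℚ.+ (h (suc L) 0 ℚ.+ s)) last-row ⟩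
  R ℚ.+ (h (suc L) 0 ℚ.+ S)
    ≡⟨ solve 3 (λ r a s → r :+ (a :+ s) := r :+ s :+ a) refl R (h (suc L) 0) S ⟩
  R ℚ.+ S ℚ.+ h (suc L) 0
    ≡⟨ cong (ℚ._+ h (suc L) 0) (sym (sumTo-distrib-+ L _ _)) ⟩
  sumTo L (λ v → sumTo (suc (L ℕ.∸ v)) (column v)) ℚ.+ h (suc L) 0
    ≡⟨ cong₂ ℚ._+_ (sumTo-cong-≤ L (λ v v≤L → cong (λ m → sumTo m (column v)) (sym (ℕP.+-∸-assoc 1 v≤L))))
                   (trans (cong (λ w → h w 0) (sym (ℕP.+-identityʳ (suc L))))
                          (cong (λ m → sumTo m (column (suc L))) (sym (ℕP.n∸n≡0 L)))) ⟩
  sumTo L (λ v → sumTo (suc L ℕ.∸ v) (column v)) ℚ.+ sumTo (L ℕ.∸ L) (column (suc L))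
    ∎
  where
  column : ℕ → ℕ → ℚ
  column v n = h (v ℕ.+ n) n
  R = sumTo L (λ v → sumTo (L ℕ.∸ v) (column v))
  S = sumTo L (λ v → column v (suc (L ℕ.∸ v)))
  last-row : sumTo L (λ m → h (suc L) (suc m)) ≡ S
  last-row = begin
    sumTo L (λ m → h (suc L) (suc m))               ≡⟨ sym (sumTo-reverse L (λ m → h (suc L) (suc m))) ⟩
    sumTo L (λ v → h (suc L) (suc (L ℕ.∸ v)))       ≡⟨ sumTo-cong-≤ L (λ v v≤L → cong (λ w → h w (suc (L ℕ.∸ v)))
                                                         (sym (trans (ℕP.+-suc v (L ℕ.∸ v)) (cong suc (ℕP.m+[n∸m]≡n v≤L))))) ⟩
    S                                               ∎

-- q-binomial coefficients and q-Pascal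

vanish-*+ : ∀ {l b d} c → l ≡ 0ℚ → b ≡ 0ℚ → d ≡ 0ℚ → l ≡ c ℚ.* b ℚ.+ d
vanish-*+ c l≡0 b≡0 d≡0 = begin
  _                  ≡⟨ l≡0 ⟩
  0ℚ                 ≡⟨ solve 1 (λ c → con 0ℚ := c :* con 0ℚ :+ con 0ℚ) refl c ⟩
  c ℚ.* 0ℚ ℚ.+ 0ℚ    ≡⟨ sym (cong₂ (λ x y → c ℚ.* x ℚ.+ y) b≡0 d≡0) ⟩
  _                  ∎

data Position : ℕ → ℤ → Set where
  below  : ∀ n k → Position n -[1+ k ]
  inside : ∀ k m → Position (k ℕ.+ m) (+ k)
  above  : ∀ n k → Position n (+ (n ℕ.+ suc k))

position : ∀ n x → Position n x
position n       -[1+ k ] = below n k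
position zero    (+ zero)  = inside 0 0
position zero    (+ suc k) = above 0 k
position (suc n) (+ zero)  = inside 0 (suc n)
position (suc n) (+ suc k) with position n (+ k)
... | inside k m = inside (suc k) m
... | above n k  = above (suc n) k

module Base-q (q : ℚ) (q≢0 : q ≢ 0ℚ) (q≢1 : q ≢ 1ℚ) (q≢-1 : q ≢ ℚ.- 1ℚ) where

  q^_ : ℤ → ℚ
  q^_ = powZ q

  binom : ℕ → ℤ → ℚ
  binom n = qbin q (+ n)

  poch-*-pochInv : ∀ n → poch q n ℚ.* pochInv q (+ n) ≡ 1ℚ
  poch-*-pochInv n = inv-inverseʳ (poch q n) (poch-≢0 q≢1 q≢-1 n)

  pochInv-suc : ∀ n → pochInv q (+ suc n) ≡ pochInv q (+ n) ℚ.* inv (1ℚ ℚ.- powN q (suc n))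
  pochInv-suc n = inv-distrib-* (poch q n) _ (poch-≢0 q≢1 q≢-1 n) (1-powN-suc≢0 q≢1 q≢-1 n)

  binom-below : ∀ n k → binom n -[1+ k ] ≡ 0ℚ
  binom-below n k = trans (cong (ℚ._* pochInv q (+ n ℤ.- -[1+ k ])) (ℚP.*-zeroʳ (poch q n)))
                          (ℚP.*-zeroˡ (pochInv q (+ n ℤ.- -[1+ k ])))

  binom-above : ∀ n k j → n ℕ.+ suc j ≡ k → binom n (+ k) ≡ 0ℚ
  binom-above n .(n ℕ.+ suc j) j refl =
    trans (cong (λ w → poch q n ℚ.* pochInv q (+ (n ℕ.+ suc j)) ℚ.* pochInv q w) (n-[n+1+j] (+ n) (+ j)))
          (ℚP.*-zeroʳ (poch q n ℚ.* pochInv q (+ (n ℕ.+ suc j))))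
    where
    n-[n+1+j] : ∀ n j → n ℤ.- (n ℤ.+ (+ 1 ℤ.+ j)) ≡ ℤ.- (+ 1 ℤ.+ j)
    n-[n+1+j] = solve-∀

  binom-inside : ∀ n k m → k ℕ.+ m ≡ n → binom n (+ k) ≡ poch q n ℚ.* pochInv q (+ k) ℚ.* pochInv q (+ m)
  binom-inside .(k ℕ.+ m) k m refl =
    cong (λ w → poch q (k ℕ.+ m) ℚ.* pochInv q (+ k) ℚ.* pochInv q w) (k+m-k (+ k) (+ m))
    where
    k+m-k : ∀ k m → k ℤ.+ m ℤ.- k ≡ m
    k+m-k = solve-∀

  binom-sym : ∀ n x → binom n x ≡ binom n (+ n ℤ.- x)
  binom-sym n x = begin
    poch q n ℚ.* pochInv q x ℚ.* pochInv q (+ n ℤ.- x)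
      ≡⟨ solve 3 (λ a b c → a :* b :* c := a :* c :* b) refl (poch q n) (pochInv q x) (pochInv q (+ n ℤ.- x)) ⟩
    poch q n ℚ.* pochInv q (+ n ℤ.- x) ℚ.* pochInv q x
      ≡⟨ cong (λ w → poch q n ℚ.* pochInv q (+ n ℤ.- x) ℚ.* pochInv q w) (n-[n-x] (+ n) x) ⟩
    poch q n ℚ.* pochInv q (+ n ℤ.- x) ℚ.* pochInv q (+ n ℤ.- (+ n ℤ.- x)) ∎
    where
    n-[n-x] : ∀ n x → x ≡ n ℤ.- (n ℤ.- x)
    n-[n-x] = solve-∀

  binom-zero : ∀ n → binom n (+ 0) ≡ 1ℚ
  binom-zero n = begin
    binom n (+ 0)                                         ≡⟨ binom-inside n 0 n refl ⟩
    poch q n ℚ.* pochInv q (+ 0) ℚ.* pochInv q (+ n)      ≡⟨ cong (λ c → poch q n ℚ.* c ℚ.* pochInv q (+ n)) inv-1 ⟩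
    poch q n ℚ.* 1ℚ ℚ.* pochInv q (+ n)                   ≡⟨ cong (ℚ._* pochInv q (+ n)) (ℚP.*-identityʳ (poch q n)) ⟩
    poch q n ℚ.* pochInv q (+ n)                          ≡⟨ poch-*-pochInv n ⟩
    1ℚ                                                    ∎

  binom-diagonal : ∀ n → binom n (+ n) ≡ 1ℚ
  binom-diagonal n = trans (binom-inside n n 0 (ℕP.+-identityʳ n)) (cong₂ ℚ._*_ (poch-*-pochInv n) inv-1)

  -- Both sides reduce to the splitting 1 - q^{k+1} q^{m+1} = (1 - q^{m+1}) + q^{m+1} (1 - q^{k+1}).
  pascal-inside : ∀ k m → binom (suc (k ℕ.+ suc m)) (+ suc k)
                        ≡ powN q (suc m) ℚ.* binom (k ℕ.+ suc m) (+ k) ℚ.+ binom (k ℕ.+ suc m) (+ suc k)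
  pascal-inside k m = begin
    binom (suc (k ℕ.+ suc m)) (+ suc k)
      ≡⟨ binom-inside _ (suc k) (suc m) refl ⟩
    P ℚ.* (1ℚ ℚ.- powN q (suc k ℕ.+ suc m)) ℚ.* pochInv q (+ suc k) ℚ.* pochInv q (+ suc m)
      ≡⟨ cong (λ x → P ℚ.* (1ℚ ℚ.- x) ℚ.* pochInv q (+ suc k) ℚ.* pochInv q (+ suc m)) (powN-+ q (suc k) (suc m)) ⟩
    P ℚ.* (1ℚ ℚ.- u ℚ.* w) ℚ.* pochInv q (+ suc k) ℚ.* pochInv q (+ suc m)
      ≡⟨ cong₂ (λ x y → P ℚ.* (1ℚ ℚ.- u ℚ.* w) ℚ.* x ℚ.* y) (pochInv-suc k) (pochInv-suc m) ⟩
    P ℚ.* (1ℚ ℚ.- u ℚ.* w) ℚ.* (Iₖ ℚ.* A) ℚ.* (Iₘ ℚ.* C)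
      ≡⟨ solve 7 (λ p u w a b c d → p :* (con 1ℚ :- u :* w) :* (a :* b) :* (c :* d)
                                  := (con 1ℚ :- w) :* d :* (p :* a :* c :* b) :+ (con 1ℚ :- u) :* b :* (w :* (p :* a :* (c :* d))))
               refl P u w Iₖ A Iₘ C ⟩
    (1ℚ ℚ.- w) ℚ.* C ℚ.* (P ℚ.* Iₖ ℚ.* Iₘ ℚ.* A) ℚ.+ (1ℚ ℚ.- u) ℚ.* A ℚ.* (w ℚ.* (P ℚ.* Iₖ ℚ.* (Iₘ ℚ.* C)))
      ≡⟨ cong₂ (λ x y → x ℚ.* (P ℚ.* Iₖ ℚ.* Iₘ ℚ.* A) ℚ.+ y ℚ.* (w ℚ.* (P ℚ.* Iₖ ℚ.* (Iₘ ℚ.* C))))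
               (inv-inverseʳ _ (1-powN-suc≢0 q≢1 q≢-1 m)) (inv-inverseʳ _ (1-powN-suc≢0 q≢1 q≢-1 k)) ⟩
    1ℚ ℚ.* (P ℚ.* Iₖ ℚ.* Iₘ ℚ.* A) ℚ.+ 1ℚ ℚ.* (w ℚ.* (P ℚ.* Iₖ ℚ.* (Iₘ ℚ.* C)))
      ≡⟨ solve 6 (λ p a c b d w → con 1ℚ :* (p :* a :* c :* b) :+ con 1ℚ :* (w :* (p :* a :* (c :* d)))
                                := w :* (p :* a :* (c :* d)) :+ p :* (a :* b) :* c)
               refl P Iₖ Iₘ A C w ⟩
    w ℚ.* (P ℚ.* Iₖ ℚ.* (Iₘ ℚ.* C)) ℚ.+ P ℚ.* (Iₖ ℚ.* A) ℚ.* Iₘ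
      ≡⟨ cong₂ (λ x y → w ℚ.* (P ℚ.* Iₖ ℚ.* x) ℚ.+ P ℚ.* y ℚ.* Iₘ) (sym (pochInv-suc m)) (sym (pochInv-suc k)) ⟩
    w ℚ.* (P ℚ.* Iₖ ℚ.* pochInv q (+ suc m)) ℚ.+ P ℚ.* pochInv q (+ suc k) ℚ.* Iₘ
      ≡⟨ cong₂ (λ x y → w ℚ.* x ℚ.+ y) (sym (binom-inside _ k (suc m) refl))
               (sym (binom-inside _ (suc k) m (sym (ℕP.+-suc k m)))) ⟩
    w ℚ.* binom (k ℕ.+ suc m) (+ k) ℚ.+ binom (k ℕ.+ suc m) (+ suc k) ∎
    where
    P = poch q (k ℕ.+ suc m)
    u = powN q (suc k)
    w = powN q (suc m)
    Iₖ = pochInv q (+ k)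
    Iₘ = pochInv q (+ m)
    A = inv (1ℚ ℚ.- u)
    C = inv (1ℚ ℚ.- w)

  pascal-suc : ∀ n y → binom (suc n) (ℤ.suc y) ≡ q^ (+ n ℤ.- y) ℚ.* binom n y ℚ.+ binom n (ℤ.suc y)
  pascal-suc n y with position n y
  ... | below .n zero = begin
    binom (suc n) (+ 0)                   ≡⟨ trans (binom-zero (suc n)) (sym (binom-zero n)) ⟩
    binom n (+ 0)                         ≡⟨ solve 2 (λ c b → b := c :* con 0ℚ :+ b) refl (q^ (+ n ℤ.- -1ℤ)) (binom n (+ 0)) ⟩
    q^ (+ n ℤ.- -1ℤ) ℚ.* 0ℚ ℚ.+ binom n (+ 0)
                                          ≡⟨ cong (λ b → q^ (+ n ℤ.- -1ℤ) ℚ.* b ℚ.+ binom n (+ 0)) (sym (binom-below n 0)) ⟩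
    q^ (+ n ℤ.- -1ℤ) ℚ.* binom n -1ℤ ℚ.+ binom n (+ 0) ∎
  ... | below .n (suc k) = vanish-*+ (q^ (+ n ℤ.- -[1+ suc k ])) (binom-below (suc n) k) (binom-below n (suc k)) (binom-below n k)
  ... | above .n k = vanish-*+ (q^ (+ n ℤ.- + (n ℕ.+ suc k))) (binom-above (suc n) _ k refl) (binom-above n _ k refl)
                               (binom-above n _ (suc k) (ℕP.+-suc n (suc k)))
  ... | inside k zero rewrite ℕP.+-identityʳ k = begin
    binom (suc k) (+ suc k)                             ≡⟨ binom-diagonal (suc k) ⟩
    1ℚ                                                  ≡⟨ cong₂ (λ x y → x ℚ.* y ℚ.+ 0ℚ) (cong q^_ (sym (ℤP.+-inverseʳ (+ k))))
                                                             (sym (binom-diagonal k)) ⟩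
    q^ (+ k ℤ.- + k) ℚ.* binom k (+ k) ℚ.+ 0ℚ           ≡⟨ cong (q^ (+ k ℤ.- + k) ℚ.* binom k (+ k) ℚ.+_)
                                                             (sym (binom-above k (suc k) 0 (ℕP.+-comm k 1))) ⟩
    q^ (+ k ℤ.- + k) ℚ.* binom k (+ k) ℚ.+ binom k (+ suc k) ∎
  ... | inside k (suc m) = trans (pascal-inside k m)
          (cong (λ e → q^ e ℚ.* binom (k ℕ.+ suc m) (+ k) ℚ.+ binom (k ℕ.+ suc m) (+ suc k)) (sym (k+m-k (+ k) (+ suc m))))
    where
    k+m-k : ∀ k m → k ℤ.+ m ℤ.- k ≡ m
    k+m-k = solve-∀

  pascal-right : ∀ n x → binom (suc n) x ≡ q^ (+ suc n ℤ.- x) ℚ.* binom n (x ℤ.- + 1) ℚ.+ binom n x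
  pascal-right n x = begin
    binom (suc n) x
      ≡⟨ cong (binom (suc n)) (sym (suc-pred x)) ⟩
    binom (suc n) (ℤ.suc (x ℤ.- + 1))
      ≡⟨ pascal-suc n (x ℤ.- + 1) ⟩
    q^ (+ n ℤ.- (x ℤ.- + 1)) ℚ.* binom n (x ℤ.- + 1) ℚ.+ binom n (ℤ.suc (x ℤ.- + 1))
      ≡⟨ cong₂ (λ e y → q^ e ℚ.* binom n (x ℤ.- + 1) ℚ.+ binom n y) (shift (+ n) x) (suc-pred x) ⟩
    q^ (+ suc n ℤ.- x) ℚ.* binom n (x ℤ.- + 1) ℚ.+ binom n x ∎
    where
    suc-pred : ∀ x → + 1 ℤ.+ (x ℤ.- + 1) ≡ x
    suc-pred = solve-∀
    shift : ∀ n x → n ℤ.- (x ℤ.- + 1) ≡ + 1 ℤ.+ n ℤ.- x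
    shift = solve-∀

  pascal-left : ∀ n x → binom (suc n) x ≡ q^ x ℚ.* binom n x ℚ.+ binom n (x ℤ.- + 1)
  pascal-left n x = begin
    binom (suc n) x
      ≡⟨ binom-sym (suc n) x ⟩
    binom (suc n) (+ suc n ℤ.- x)
      ≡⟨ pascal-right n (+ suc n ℤ.- x) ⟩
    q^ (+ suc n ℤ.- (+ suc n ℤ.- x)) ℚ.* binom n (+ suc n ℤ.- x ℤ.- + 1) ℚ.+ binom n (+ suc n ℤ.- x)
      ≡⟨ cong₂ (λ e y → q^ e ℚ.* binom n y ℚ.+ binom n (+ suc n ℤ.- x)) (n-[n-x] (+ 1 ℤ.+ + n) x) (reflect₁ (+ n) x) ⟩
    q^ x ℚ.* binom n (+ n ℤ.- x) ℚ.+ binom n (+ suc n ℤ.- x)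
      ≡⟨ cong₂ (λ y z → q^ x ℚ.* y ℚ.+ z) (sym (binom-sym n x))
               (trans (cong (binom n) (reflect₂ (+ n) x)) (sym (binom-sym n (x ℤ.- + 1)))) ⟩
    q^ x ℚ.* binom n x ℚ.+ binom n (x ℤ.- + 1) ∎
    where
    n-[n-x] : ∀ n x → n ℤ.- (n ℤ.- x) ≡ x
    n-[n-x] = solve-∀
    reflect₁ : ∀ n x → + 1 ℤ.+ n ℤ.- x ℤ.- + 1 ≡ n ℤ.- x
    reflect₁ = solve-∀
    reflect₂ : ∀ n x → + 1 ℤ.+ n ℤ.- x ≡ n ℤ.- (x ℤ.- + 1)
    reflect₂ = solve-∀

  -- q-Chu-Vandermonde

  vandermonde-term : ℕ → ℕ → ℤ → ℕ → ℚ
  vandermonde-term N u A n = q^ (+ n ℤ.* (+ n ℤ.+ A)) ℚ.* binom N (+ n) ℚ.* binom u (+ n ℤ.+ A)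

  binom-0 : ∀ y → y ≢ + 0 → binom 0 y ≡ 0ℚ
  binom-0 -[1+ k ]  _   = binom-below 0 k
  binom-0 (+ zero)  y≢0 = ⊥-elim (y≢0 refl)
  binom-0 (+ suc k) _   = binom-above 0 (suc k) k refl

  vandermonde-term-0 : ∀ N A n → + n ℤ.+ A ≢ + 0 → vandermonde-term N 0 A n ≡ 0ℚ
  vandermonde-term-0 N A n n+A≢0 =
    trans (cong (q^ (+ n ℤ.* (+ n ℤ.+ A)) ℚ.* binom N (+ n) ℚ.*_) (binom-0 (+ n ℤ.+ A) n+A≢0))
          (ℚP.*-zeroʳ (q^ (+ n ℤ.* (+ n ℤ.+ A)) ℚ.* binom N (+ n)))

  vandermonde-base : ∀ N A → sumTo N (vandermonde-term N 0 A) ≡ binom N (ℤ.- A)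
  vandermonde-base N (+ zero) = begin
    sumTo N (vandermonde-term N 0 (+ 0))
      ≡⟨ sumTo-single N 0 _ z≤n (λ k k≢0 → vandermonde-term-0 N (+ 0) k (k≢0 ∘ k+0≡0⇒k≡0 k)) ⟩
    1ℚ ℚ.* binom N (+ 0) ℚ.* binom 0 (+ 0)
      ≡⟨ cong (1ℚ ℚ.* binom N (+ 0) ℚ.*_) (binom-zero 0) ⟩
    1ℚ ℚ.* binom N (+ 0) ℚ.* 1ℚ
      ≡⟨ solve 1 (λ b → con 1ℚ :* b :* con 1ℚ := b) refl (binom N (+ 0)) ⟩
    binom N (+ 0) ∎
    where
    k+0≡0⇒k≡0 : ∀ k → + k ℤ.+ + 0 ≡ + 0 → k ≡ 0
    k+0≡0⇒k≡0 k k+0≡0 = trans (sym (ℕP.+-identityʳ k)) (ℤP.+-injective k+0≡0)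
  vandermonde-base N (+ suc a) = begin
    sumTo N (vandermonde-term N 0 (+ suc a))
      ≡⟨ sumTo-zero N _ (λ k _ → vandermonde-term-0 N (+ suc a) k
                                   (λ k+1+a≡0 → ℕP.0≢1+n (sym (trans (sym (ℕP.+-suc k a)) (ℤP.+-injective k+1+a≡0))))) ⟩
    0ℚ
      ≡⟨ sym (binom-below N a) ⟩
    binom N -[1+ a ] ∎
  vandermonde-base N -[1+ a ] with suc a ℕP.≤? N
  ... | yes 1+a≤N = begin
    sumTo N (vandermonde-term N 0 -[1+ a ])
      ≡⟨ sumTo-single N (suc a) _ 1+a≤N (λ k k≢1+a → vandermonde-term-0 N -[1+ a ] k (k≢1+a ∘ k-[1+a]≡0⇒k≡1+a k a)) ⟩
    q^ (+ suc a ℤ.* (+ suc a ℤ.+ -[1+ a ])) ℚ.* binom N (+ suc a) ℚ.* binom 0 (+ suc a ℤ.+ -[1+ a ])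
      ≡⟨ cong (λ y → q^ (+ suc a ℤ.* y) ℚ.* binom N (+ suc a) ℚ.* binom 0 y) (ℤP.+-inverseʳ (+ suc a)) ⟩
    q^ (+ suc a ℤ.* + 0) ℚ.* binom N (+ suc a) ℚ.* binom 0 (+ 0)
      ≡⟨ cong₂ (λ e b → q^ e ℚ.* binom N (+ suc a) ℚ.* b) (ℤP.*-zeroʳ (+ suc a)) (binom-zero 0) ⟩
    1ℚ ℚ.* binom N (+ suc a) ℚ.* 1ℚ
      ≡⟨ solve 1 (λ b → con 1ℚ :* b :* con 1ℚ := b) refl (binom N (+ suc a)) ⟩
    binom N (+ suc a) ∎
  ... | no 1+a≰N = begin
    sumTo N (vandermonde-term N 0 -[1+ a ])
      ≡⟨ sumTo-zero N _ (λ k k≤N → vandermonde-term-0 N -[1+ a ] k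
                                     (λ e → 1+a≰N (subst (_≤ N) (k-[1+a]≡0⇒k≡1+a k a e) k≤N))) ⟩
    0ℚ
      ≡⟨ sym (binom-above N (suc a) (a ℕ.∸ N) (trans (ℕP.+-suc N (a ℕ.∸ N)) (cong suc (ℕP.m+[n∸m]≡n N≤a)))) ⟩
    binom N (+ suc a) ∎
    where
    N≤a : N ≤ a
    N≤a = ℕP.≤-pred (ℕP.≰⇒> 1+a≰N)

  vandermonde-term-suc : ∀ N u A n → vandermonde-term N (suc u) A n
    ≡ q^ (+ suc u ℤ.- A) ℚ.* vandermonde-term N u (A ℤ.- + 1) n ℚ.+ vandermonde-term N u A n
  vandermonde-term-suc N u A n = begin
    q^ e ℚ.* b ℚ.* binom (suc u) (+ n ℤ.+ A)
      ≡⟨ cong (q^ e ℚ.* b ℚ.*_) (pascal-right u (+ n ℤ.+ A)) ⟩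
    q^ e ℚ.* b ℚ.* (q^ (+ suc u ℤ.- (+ n ℤ.+ A)) ℚ.* binom u (+ n ℤ.+ A ℤ.- + 1) ℚ.+ binom u (+ n ℤ.+ A))
      ≡⟨ solve 5 (λ x b y c d → x :* b :* (y :* c :+ d) := x :* y :* b :* c :+ x :* b :* d)
               refl (q^ e) b (q^ (+ suc u ℤ.- (+ n ℤ.+ A))) (binom u (+ n ℤ.+ A ℤ.- + 1)) (binom u (+ n ℤ.+ A)) ⟩
    q^ e ℚ.* q^ (+ suc u ℤ.- (+ n ℤ.+ A)) ℚ.* b ℚ.* binom u (+ n ℤ.+ A ℤ.- + 1) ℚ.+ vandermonde-term N u A n
      ≡⟨ cong₂ (λ x y → x ℚ.* b ℚ.* binom u y ℚ.+ vandermonde-term N u A n) exponents (ℤP.+-assoc (+ n) A -1ℤ) ⟩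
    q^ e′ ℚ.* q^ (+ suc u ℤ.- A) ℚ.* b ℚ.* binom u (+ n ℤ.+ (A ℤ.- + 1)) ℚ.+ vandermonde-term N u A n
      ≡⟨ cong (ℚ._+ vandermonde-term N u A n)
              (solve 4 (λ x y b c → x :* y :* b :* c := y :* (x :* b :* c)) refl (q^ e′) (q^ (+ suc u ℤ.- A)) b _) ⟩
    q^ (+ suc u ℤ.- A) ℚ.* vandermonde-term N u (A ℤ.- + 1) n ℚ.+ vandermonde-term N u A n ∎
    where
    e  = + n ℤ.* (+ n ℤ.+ A)
    e′ = + n ℤ.* (+ n ℤ.+ (A ℤ.- + 1))
    b  = binom N (+ n)
    exponent-shift : ∀ n u A → n ℤ.* (n ℤ.+ A) ℤ.+ (+ 1 ℤ.+ u ℤ.- (n ℤ.+ A))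
                               ≡ n ℤ.* (n ℤ.+ (A ℤ.- + 1)) ℤ.+ (+ 1 ℤ.+ u ℤ.- A)
    exponent-shift = solve-∀
    exponents : q^ e ℚ.* q^ (+ suc u ℤ.- (+ n ℤ.+ A)) ≡ q^ e′ ℚ.* q^ (+ suc u ℤ.- A)
    exponents = begin
      q^ e ℚ.* q^ (+ suc u ℤ.- (+ n ℤ.+ A))     ≡⟨ sym (powZ-+ q≢0 e _) ⟩
      q^ (e ℤ.+ (+ suc u ℤ.- (+ n ℤ.+ A)))     ≡⟨ cong q^_ (exponent-shift (+ n) (+ u) A) ⟩
      q^ (e′ ℤ.+ (+ suc u ℤ.- A))              ≡⟨ powZ-+ q≢0 e′ _ ⟩
      q^ e′ ℚ.* q^ (+ suc u ℤ.- A)             ∎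

  vandermonde : ∀ u N A → sumTo N (vandermonde-term N u A) ≡ binom (N ℕ.+ u) (+ N ℤ.+ A)
  vandermonde zero N A = begin
    sumTo N (vandermonde-term N 0 A)  ≡⟨ vandermonde-base N A ⟩
    binom N (ℤ.- A)                   ≡⟨ binom-sym N (ℤ.- A) ⟩
    binom N (+ N ℤ.- ℤ.- A)           ≡⟨ cong₂ binom (sym (ℕP.+-identityʳ N)) (x--y (+ N) A) ⟩
    binom (N ℕ.+ 0) (+ N ℤ.+ A)       ∎
    where
    x--y : ∀ x y → x ℤ.- ℤ.- y ≡ x ℤ.+ y
    x--y = solve-∀
  vandermonde (suc u) N A = begin
    sumTo N (vandermonde-term N (suc u) A)
      ≡⟨ sumTo-cong N (vandermonde-term-suc N u A) ⟩
    sumTo N (λ n → c ℚ.* vandermonde-term N u (A ℤ.- + 1) n ℚ.+ vandermonde-term N u A n)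
      ≡⟨ sumTo-distrib-+ N _ _ ⟩
    sumTo N (λ n → c ℚ.* vandermonde-term N u (A ℤ.- + 1) n) ℚ.+ sumTo N (vandermonde-term N u A)
      ≡⟨ cong₂ ℚ._+_ (sumTo-*ˡ N c _) (vandermonde u N A) ⟩
    c ℚ.* sumTo N (vandermonde-term N u (A ℤ.- + 1)) ℚ.+ binom (N ℕ.+ u) (+ N ℤ.+ A)
      ≡⟨ cong (λ s → c ℚ.* s ℚ.+ binom (N ℕ.+ u) (+ N ℤ.+ A)) (vandermonde u N (A ℤ.- + 1)) ⟩
    c ℚ.* binom (N ℕ.+ u) (+ N ℤ.+ (A ℤ.- + 1)) ℚ.+ binom (N ℕ.+ u) (+ N ℤ.+ A)
      ≡⟨ cong₂ (λ e y → q^ e ℚ.* binom (N ℕ.+ u) y ℚ.+ binom (N ℕ.+ u) (+ N ℤ.+ A))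
               (top-shift (+ N) (+ u) A) (sym (ℤP.+-assoc (+ N) A -1ℤ)) ⟩
    q^ (+ suc (N ℕ.+ u) ℤ.- (+ N ℤ.+ A)) ℚ.* binom (N ℕ.+ u) (+ N ℤ.+ A ℤ.- + 1) ℚ.+ binom (N ℕ.+ u) (+ N ℤ.+ A)
      ≡⟨ sym (pascal-right (N ℕ.+ u) (+ N ℤ.+ A)) ⟩
    binom (suc (N ℕ.+ u)) (+ N ℤ.+ A)
      ≡⟨ cong (λ m → binom m (+ N ℤ.+ A)) (sym (ℕP.+-suc N u)) ⟩
    binom (N ℕ.+ suc u) (+ N ℤ.+ A) ∎
    where
    c = q^ (+ suc u ℤ.- A)
    top-shift : ∀ N u A → + 1 ℤ.+ u ℤ.- A ≡ + 1 ℤ.+ (N ℤ.+ u) ℤ.- (N ℤ.+ A)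
    top-shift = solve-∀

  -- From base 1/q to base q

  powZ-1/q : ∀ z → powZ (inv q) z ≡ q^ (ℤ.- z)
  powZ-1/q (+ zero)  = refl
  powZ-1/q (+ suc m) = powN-inv q≢0 (suc m)
  powZ-1/q -[1+ m ]  = trans (cong inv (powN-inv q≢0 (suc m))) (inv-involutive _ (powN-≢0 q≢0 (suc m)))

  poch-1/q-normalised : ∀ m → poch (inv q) m ℚ.* sign (+ m) ℚ.* q^ (+ triangleℕ m) ≡ poch q m
  poch-1/q-normalised zero    = refl
  poch-1/q-normalised (suc m) = begin
    poch (inv q) m ℚ.* (1ℚ ℚ.- powN (inv q) (suc m)) ℚ.* (ℚ.- 1ℚ ℚ.* sign (+ m)) ℚ.* q^ (+ (suc m ℕ.+ triangleℕ m))
      ≡⟨ cong₂ (λ x y → poch (inv q) m ℚ.* (1ℚ ℚ.- x) ℚ.* (ℚ.- 1ℚ ℚ.* sign (+ m)) ℚ.* y) (powN-inv q≢0 (suc m))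
               (trans (cong q^_ (ℤP.pos-+ (suc m) (triangleℕ m))) (powZ-+ q≢0 (+ suc m) (+ triangleℕ m))) ⟩
    poch (inv q) m ℚ.* (1ℚ ℚ.- inv w) ℚ.* (ℚ.- 1ℚ ℚ.* sign (+ m)) ℚ.* (w ℚ.* q^ (+ triangleℕ m))
      ≡⟨ solve 5 (λ p v s w t → p :* (con 1ℚ :- v) :* (:- con 1ℚ :* s) :* (w :* t) := p :* s :* t :* (w :* v :- w))
               refl (poch (inv q) m) (inv w) (sign (+ m)) w (q^ (+ triangleℕ m)) ⟩
    poch (inv q) m ℚ.* sign (+ m) ℚ.* q^ (+ triangleℕ m) ℚ.* (w ℚ.* inv w ℚ.- w)
      ≡⟨ cong₂ (λ x y → x ℚ.* (y ℚ.- w)) (poch-1/q-normalised m) (inv-inverseʳ w (powN-≢0 q≢0 (suc m))) ⟩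
    poch q m ℚ.* (1ℚ ℚ.- w) ∎
    where w = powN q (suc m)

  poch-1/q-≢0 : ∀ m → poch (inv q) m ≢ 0ℚ
  poch-1/q-≢0 m poch≡0 = poch-≢0 q≢1 q≢-1 m (begin
    poch q m                                               ≡⟨ sym (poch-1/q-normalised m) ⟩
    poch (inv q) m ℚ.* sign (+ m) ℚ.* q^ (+ triangleℕ m)   ≡⟨ cong (λ p → p ℚ.* sign (+ m) ℚ.* q^ (+ triangleℕ m)) poch≡0 ⟩
    0ℚ ℚ.* sign (+ m) ℚ.* q^ (+ triangleℕ m)               ≡⟨ solve 2 (λ a b → con 0ℚ :* a :* b := con 0ℚ) refl (sign (+ m)) _ ⟩
    0ℚ                                                     ∎)

  poch-1/q : ∀ m → poch (inv q) m ≡ poch q m ℚ.* sign (+ m) ℚ.* q^ (ℤ.- + triangleℕ m)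
  poch-1/q m = begin
    poch (inv q) m
      ≡⟨ solve 1 (λ p → p := p :* con 1ℚ :* con 1ℚ) refl (poch (inv q) m) ⟩
    poch (inv q) m ℚ.* 1ℚ ℚ.* 1ℚ
      ≡⟨ cong₂ (λ x y → poch (inv q) m ℚ.* x ℚ.* y) (sym (sign-square (+ m)))
               (sym (trans (sym (powZ-+ q≢0 t (ℤ.- t))) (cong q^_ (ℤP.+-inverseʳ t)))) ⟩
    poch (inv q) m ℚ.* (sign (+ m) ℚ.* sign (+ m)) ℚ.* (q^ t ℚ.* q^ (ℤ.- t))
      ≡⟨ solve 5 (λ p a b c d → p :* (a :* b) :* (c :* d) := p :* a :* c :* b :* d)
               refl (poch (inv q) m) (sign (+ m)) (sign (+ m)) (q^ t) (q^ (ℤ.- t)) ⟩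
    poch (inv q) m ℚ.* sign (+ m) ℚ.* q^ t ℚ.* sign (+ m) ℚ.* q^ (ℤ.- t)
      ≡⟨ cong (λ p → p ℚ.* sign (+ m) ℚ.* q^ (ℤ.- t)) (poch-1/q-normalised m) ⟩
    poch q m ℚ.* sign (+ m) ℚ.* q^ (ℤ.- t) ∎
    where t = + triangleℕ m

  pochInv-1/q : ∀ x → pochInv (inv q) x ≡ sign x ℚ.* q^ (triangle x) ℚ.* pochInv q x
  pochInv-1/q (+ m)    = sym (inv-unique (poch (inv q) m) _ (poch-1/q-≢0 m) (begin
    sign (+ m) ℚ.* q^ (+ triangleℕ m) ℚ.* inv (poch q m) ℚ.* poch (inv q) m
      ≡⟨ solve 4 (λ a b c d → a :* b :* c :* d := d :* a :* b :* c) refl (sign (+ m)) (q^ (+ triangleℕ m)) (inv (poch q m)) (poch (inv q) m) ⟩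
    poch (inv q) m ℚ.* sign (+ m) ℚ.* q^ (+ triangleℕ m) ℚ.* inv (poch q m)
      ≡⟨ cong (ℚ._* inv (poch q m)) (poch-1/q-normalised m) ⟩
    poch q m ℚ.* inv (poch q m)
      ≡⟨ poch-*-pochInv m ⟩
    1ℚ ∎))
  pochInv-1/q -[1+ k ] = sym (ℚP.*-zeroʳ (sign -[1+ k ] ℚ.* q^ (+ triangleℕ k)))

  trinomial-powers : ∀ i n a →
    q^ (triangle i) ℚ.* q^ (triangle i ℤ.- triangle a) ℚ.* q^ (ℤ.- (n ℤ.* (n ℤ.+ (a ℤ.+ + 1)))) ℚ.* q^ (ℤ.- triangle i)
      ℚ.* q^ (triangle n) ℚ.* q^ (triangle (n ℤ.+ a)) ℚ.* q^ (triangle (i ℤ.- + 2 ℤ.* n ℤ.- a))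
    ≡ q^ (triangle a) ℚ.* q^ (n ℤ.* (n ℤ.+ a) ℤ.+ (i ℤ.- n ℤ.+ + 1) ℤ.* (i ℤ.- n ℤ.- a))
  trinomial-powers i n a = begin
    q^ tᵢ ℚ.* q^ (tᵢ ℤ.- tₐ) ℚ.* q^ (ℤ.- c) ℚ.* q^ (ℤ.- tᵢ) ℚ.* q^ tₙ ℚ.* q^ tₙₐ ℚ.* q^ tₖ
      ≡⟨ cong (λ x → x ℚ.* q^ (ℤ.- c) ℚ.* q^ (ℤ.- tᵢ) ℚ.* q^ tₙ ℚ.* q^ tₙₐ ℚ.* q^ tₖ) (merge tᵢ (tᵢ ℤ.- tₐ)) ⟩
    q^ (tᵢ ℤ.+ (tᵢ ℤ.- tₐ)) ℚ.* q^ (ℤ.- c) ℚ.* q^ (ℤ.- tᵢ) ℚ.* q^ tₙ ℚ.* q^ tₙₐ ℚ.* q^ tₖ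
      ≡⟨ cong (λ x → x ℚ.* q^ (ℤ.- tᵢ) ℚ.* q^ tₙ ℚ.* q^ tₙₐ ℚ.* q^ tₖ) (merge (tᵢ ℤ.+ (tᵢ ℤ.- tₐ)) (ℤ.- c)) ⟩
    q^ (tᵢ ℤ.+ (tᵢ ℤ.- tₐ) ℤ.+ ℤ.- c) ℚ.* q^ (ℤ.- tᵢ) ℚ.* q^ tₙ ℚ.* q^ tₙₐ ℚ.* q^ tₖ
      ≡⟨ cong (λ x → x ℚ.* q^ tₙ ℚ.* q^ tₙₐ ℚ.* q^ tₖ) (merge (tᵢ ℤ.+ (tᵢ ℤ.- tₐ) ℤ.+ ℤ.- c) (ℤ.- tᵢ)) ⟩
    q^ (tᵢ ℤ.+ (tᵢ ℤ.- tₐ) ℤ.+ ℤ.- c ℤ.+ ℤ.- tᵢ) ℚ.* q^ tₙ ℚ.* q^ tₙₐ ℚ.* q^ tₖ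
      ≡⟨ cong (λ x → x ℚ.* q^ tₙₐ ℚ.* q^ tₖ) (merge (tᵢ ℤ.+ (tᵢ ℤ.- tₐ) ℤ.+ ℤ.- c ℤ.+ ℤ.- tᵢ) tₙ) ⟩
    q^ (tᵢ ℤ.+ (tᵢ ℤ.- tₐ) ℤ.+ ℤ.- c ℤ.+ ℤ.- tᵢ ℤ.+ tₙ) ℚ.* q^ tₙₐ ℚ.* q^ tₖ
      ≡⟨ cong (ℚ._* q^ tₖ) (merge (tᵢ ℤ.+ (tᵢ ℤ.- tₐ) ℤ.+ ℤ.- c ℤ.+ ℤ.- tᵢ ℤ.+ tₙ) tₙₐ) ⟩
    q^ (tᵢ ℤ.+ (tᵢ ℤ.- tₐ) ℤ.+ ℤ.- c ℤ.+ ℤ.- tᵢ ℤ.+ tₙ ℤ.+ tₙₐ) ℚ.* q^ tₖ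
      ≡⟨ merge (tᵢ ℤ.+ (tᵢ ℤ.- tₐ) ℤ.+ ℤ.- c ℤ.+ ℤ.- tᵢ ℤ.+ tₙ ℤ.+ tₙₐ) tₖ ⟩
    q^ (tᵢ ℤ.+ (tᵢ ℤ.- tₐ) ℤ.+ ℤ.- c ℤ.+ ℤ.- tᵢ ℤ.+ tₙ ℤ.+ tₙₐ ℤ.+ tₖ)
      ≡⟨ cong q^_ (trinomial-exponent i n a) ⟩
    q^ (tₐ ℤ.+ e)
      ≡⟨ powZ-+ q≢0 tₐ e ⟩
    q^ tₐ ℚ.* q^ e ∎
    where
    c = n ℤ.* (n ℤ.+ (a ℤ.+ + 1))
    e = n ℤ.* (n ℤ.+ a) ℤ.+ (i ℤ.- n ℤ.+ + 1) ℤ.* (i ℤ.- n ℤ.- a)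
    tᵢ = triangle i
    tₐ = triangle a
    tₙ = triangle n
    tₙₐ = triangle (n ℤ.+ a)
    tₖ = triangle (i ℤ.- + 2 ℤ.* n ℤ.- a)
    merge : ∀ x y → q^ x ℚ.* q^ y ≡ q^ (x ℤ.+ y)
    merge x y = sym (powZ-+ q≢0 x y)

  -- The summand of trinom (inv q) i (a ℤ.- -1ℤ) a, the sum inside T q -1ℤ i a.
  dual-trinomial-term : ℕ → ℤ → ℕ → ℚ
  dual-trinomial-term i a n = powZ (inv q) (+ n ℤ.* (+ n ℤ.+ (a ℤ.- -1ℤ))) ℚ.* poch (inv q) i ℚ.* pochInv (inv q) (+ n)
    ℚ.* pochInv (inv q) (+ n ℤ.+ a) ℚ.* pochInv (inv q) (+ i ℤ.- + 2 ℤ.* + n ℤ.- a)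

  trinomial-term : ℕ → ℤ → ℕ → ℚ
  trinomial-term i a n = q^ (+ n ℤ.* (+ n ℤ.+ a) ℤ.+ (+ i ℤ.- + n ℤ.+ + 1) ℤ.* (+ i ℤ.- + n ℤ.- a))
    ℚ.* poch q i ℚ.* pochInv q (+ n) ℚ.* pochInv q (+ n ℤ.+ a) ℚ.* pochInv q (+ i ℤ.- + 2 ℤ.* + n ℤ.- a)

  dual-trinomial-term≡trinomial-term : ∀ i a n →
    q^ (triangle (+ i)) ℚ.* (q^ (triangle (+ i) ℤ.- triangle a) ℚ.* dual-trinomial-term i a n)
      ≡ q^ (triangle a) ℚ.* trinomial-term i a n
  dual-trinomial-term≡trinomial-term i a n = begin
    q^ tᵢ ℚ.* (q^ (tᵢ ℤ.- tₐ) ℚ.* dual-trinomial-term i a n)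
      ≡⟨ cong (λ z → q^ tᵢ ℚ.* (q^ (tᵢ ℤ.- tₐ) ℚ.* z))
              (cong₂ ℚ._*_ (cong₂ ℚ._*_ (cong₂ ℚ._*_ (cong₂ ℚ._*_ (powZ-1/q c) (poch-1/q i))
                 (pochInv-1/q (+ n))) (pochInv-1/q (+ n ℤ.+ a))) (pochInv-1/q k)) ⟩
    q^ tᵢ ℚ.* (q^ (tᵢ ℤ.- tₐ) ℚ.* (q^ (ℤ.- c) ℚ.* (poch q i ℚ.* sign (+ i) ℚ.* q^ (ℤ.- tᵢ))
      ℚ.* (sign (+ n) ℚ.* q^ tₙ ℚ.* Iₙ) ℚ.* (sign (+ n ℤ.+ a) ℚ.* q^ tₙₐ ℚ.* Iₙₐ) ℚ.* (sign k ℚ.* q^ tₖ ℚ.* Iₖ)))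
      ≡⟨ solve 15 (λ p₁ p₂ p₃ P s₁ p₄ s₂ p₅ I₂ s₃ p₆ I₃ s₄ p₇ I₄ →
                    p₁ :* (p₂ :* (p₃ :* (P :* s₁ :* p₄) :* (s₂ :* p₅ :* I₂) :* (s₃ :* p₆ :* I₃) :* (s₄ :* p₇ :* I₄)))
                 := s₁ :* s₂ :* s₃ :* s₄ :* (p₁ :* p₂ :* p₃ :* p₄ :* p₅ :* p₆ :* p₇) :* (P :* I₂ :* I₃ :* I₄))
               refl (q^ tᵢ) (q^ (tᵢ ℤ.- tₐ)) (q^ (ℤ.- c)) (poch q i) (sign (+ i)) (q^ (ℤ.- tᵢ))
                    (sign (+ n)) (q^ tₙ) Iₙ (sign (+ n ℤ.+ a)) (q^ tₙₐ) Iₙₐ (sign k) (q^ tₖ) Iₖ ⟩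
    sign (+ i) ℚ.* sign (+ n) ℚ.* sign (+ n ℤ.+ a) ℚ.* sign k
      ℚ.* (q^ tᵢ ℚ.* q^ (tᵢ ℤ.- tₐ) ℚ.* q^ (ℤ.- c) ℚ.* q^ (ℤ.- tᵢ) ℚ.* q^ tₙ ℚ.* q^ tₙₐ ℚ.* q^ tₖ)
      ℚ.* (poch q i ℚ.* Iₙ ℚ.* Iₙₐ ℚ.* Iₖ)
      ≡⟨ cong₂ (λ x y → x ℚ.* y ℚ.* (poch q i ℚ.* Iₙ ℚ.* Iₙₐ ℚ.* Iₖ)) (sign-trinomial i (+ n) a) (trinomial-powers (+ i) (+ n) a) ⟩
    1ℚ ℚ.* (q^ tₐ ℚ.* q^ e) ℚ.* (poch q i ℚ.* Iₙ ℚ.* Iₙₐ ℚ.* Iₖ)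
      ≡⟨ solve 6 (λ x y P a b c → con 1ℚ :* (x :* y) :* (P :* a :* b :* c) := x :* (y :* P :* a :* b :* c))
               refl (q^ tₐ) (q^ e) (poch q i) Iₙ Iₙₐ Iₖ ⟩
    q^ tₐ ℚ.* trinomial-term i a n ∎
    where
    c = + n ℤ.* (+ n ℤ.+ (a ℤ.- -1ℤ))
    k = + i ℤ.- + 2 ℤ.* + n ℤ.- a
    e = + n ℤ.* (+ n ℤ.+ a) ℤ.+ (+ i ℤ.- + n ℤ.+ + 1) ℤ.* (+ i ℤ.- + n ℤ.- a)
    tᵢ = triangle (+ i)
    tₐ = triangle a
    tₙ = triangle (+ n)
    tₙₐ = triangle (+ n ℤ.+ a)
    tₖ = triangle k
    Iₙ = pochInv q (+ n)
    Iₙₐ = pochInv q (+ n ℤ.+ a)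
    Iₖ = pochInv q k

  T₋₁-as-trinomial-sum : ∀ i a → q^ (triangle (+ i)) ℚ.* T q -1ℤ i a ≡ q^ (triangle a) ℚ.* sumTo i (trinomial-term i a)
  T₋₁-as-trinomial-sum i a = begin
    q^ tᵢ ℚ.* T q -1ℤ i a
      ≡⟨ cong (λ z → q^ tᵢ ℚ.* (q^ z ℚ.* sumTo i (dual-trinomial-term i a))) (triangle-difference (+ i) a) ⟩
    q^ tᵢ ℚ.* (q^ (tᵢ ℤ.- tₐ) ℚ.* sumTo i (dual-trinomial-term i a))
      ≡⟨ cong (q^ tᵢ ℚ.*_) (sym (sumTo-*ˡ i (q^ (tᵢ ℤ.- tₐ)) (dual-trinomial-term i a))) ⟩
    q^ tᵢ ℚ.* sumTo i (λ n → q^ (tᵢ ℤ.- tₐ) ℚ.* dual-trinomial-term i a n)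
      ≡⟨ sym (sumTo-*ˡ i (q^ tᵢ) _) ⟩
    sumTo i (λ n → q^ tᵢ ℚ.* (q^ (tᵢ ℤ.- tₐ) ℚ.* dual-trinomial-term i a n))
      ≡⟨ sumTo-cong i (dual-trinomial-term≡trinomial-term i a) ⟩
    sumTo i (λ n → q^ tₐ ℚ.* trinomial-term i a n)
      ≡⟨ sumTo-*ˡ i (q^ tₐ) (trinomial-term i a) ⟩
    q^ tₐ ℚ.* sumTo i (trinomial-term i a) ∎
    where
    tᵢ = triangle (+ i)
    tₐ = triangle a

  binom-*-trinomial-term : ∀ L m v n r a → v ℕ.+ m ≡ L → n ℕ.+ r ≡ m →
    binom L (+ (v ℕ.+ n)) ℚ.* trinomial-term (v ℕ.+ n) a n
      ≡ q^ ((+ v ℤ.+ + 1) ℤ.* (+ v ℤ.- a)) ℚ.* binom L (+ v) ℚ.* vandermonde-term m v a n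
  binom-*-trinomial-term .(v ℕ.+ (n ℕ.+ r)) .(n ℕ.+ r) v n r a refl refl = trans lhs (sym rhs)
    where
    L = v ℕ.+ (n ℕ.+ r)
    e₁ = + n ℤ.* (+ n ℤ.+ a)
    e₂ = (+ v ℤ.+ + 1) ℤ.* (+ v ℤ.- a)
    Iᵣ = pochInv q (+ r)
    Iₙ = pochInv q (+ n)
    Iₙₐ = pochInv q (+ n ℤ.+ a)
    Iₖ = pochInv q (+ v ℤ.- (+ n ℤ.+ a))
    core = poch q L ℚ.* Iᵣ ℚ.* Iₙ ℚ.* Iₙₐ ℚ.* Iₖ
    v+n-n : ∀ v n → v ℤ.+ n ℤ.- n ≡ v
    v+n-n = solve-∀
    v+n-2n-a : ∀ v n a → v ℤ.+ n ℤ.- + 2 ℤ.* n ℤ.- a ≡ v ℤ.- (n ℤ.+ a)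
    v+n-2n-a = solve-∀
    lhs : binom L (+ (v ℕ.+ n)) ℚ.* trinomial-term (v ℕ.+ n) a n ≡ q^ e₁ ℚ.* q^ e₂ ℚ.* core
    lhs = begin
      binom L (+ (v ℕ.+ n)) ℚ.* trinomial-term (v ℕ.+ n) a n
        ≡⟨ cong₂ ℚ._*_ (binom-inside L (v ℕ.+ n) r (ℕP.+-assoc v n r))
                 (cong₂ (λ x y → q^ x ℚ.* poch q (v ℕ.+ n) ℚ.* Iₙ ℚ.* Iₙₐ ℚ.* pochInv q y)
                        (cong (λ w → e₁ ℤ.+ (w ℤ.+ + 1) ℤ.* (w ℤ.- a)) (v+n-n (+ v) (+ n)))
                        (v+n-2n-a (+ v) (+ n) a)) ⟩
      poch q L ℚ.* I ℚ.* Iᵣ ℚ.* (q^ (e₁ ℤ.+ e₂) ℚ.* poch q (v ℕ.+ n) ℚ.* Iₙ ℚ.* Iₙₐ ℚ.* Iₖ)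
        ≡⟨ cong (λ x → poch q L ℚ.* I ℚ.* Iᵣ ℚ.* (x ℚ.* poch q (v ℕ.+ n) ℚ.* Iₙ ℚ.* Iₙₐ ℚ.* Iₖ)) (powZ-+ q≢0 e₁ e₂) ⟩
      poch q L ℚ.* I ℚ.* Iᵣ ℚ.* (q^ e₁ ℚ.* q^ e₂ ℚ.* poch q (v ℕ.+ n) ℚ.* Iₙ ℚ.* Iₙₐ ℚ.* Iₖ)
        ≡⟨ solve 9 (λ P I Iᵣ x y Q Iₙ Iₙₐ Iₖ → P :* I :* Iᵣ :* (x :* y :* Q :* Iₙ :* Iₙₐ :* Iₖ)
                                            := Q :* I :* (x :* y :* (P :* Iᵣ :* Iₙ :* Iₙₐ :* Iₖ)))
                 refl (poch q L) I Iᵣ (q^ e₁) (q^ e₂) (poch q (v ℕ.+ n)) Iₙ Iₙₐ Iₖ ⟩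
      poch q (v ℕ.+ n) ℚ.* I ℚ.* (q^ e₁ ℚ.* q^ e₂ ℚ.* core)
        ≡⟨ cong (ℚ._* (q^ e₁ ℚ.* q^ e₂ ℚ.* core)) (poch-*-pochInv (v ℕ.+ n)) ⟩
      1ℚ ℚ.* (q^ e₁ ℚ.* q^ e₂ ℚ.* core)
        ≡⟨ ℚP.*-identityˡ _ ⟩
      q^ e₁ ℚ.* q^ e₂ ℚ.* core ∎
      where
      I = pochInv q (+ (v ℕ.+ n))
    rhs : q^ e₂ ℚ.* binom L (+ v) ℚ.* vandermonde-term (n ℕ.+ r) v a n ≡ q^ e₁ ℚ.* q^ e₂ ℚ.* core
    rhs = begin
      q^ e₂ ℚ.* binom L (+ v) ℚ.* (q^ e₁ ℚ.* binom (n ℕ.+ r) (+ n) ℚ.* binom v (+ n ℤ.+ a))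
        ≡⟨ cong₂ (λ x y → q^ e₂ ℚ.* x ℚ.* (q^ e₁ ℚ.* y ℚ.* binom v (+ n ℤ.+ a)))
                 (binom-inside L v (n ℕ.+ r) refl) (binom-inside (n ℕ.+ r) n r refl) ⟩
      q^ e₂ ℚ.* (poch q L ℚ.* Iᵥ ℚ.* Iₘ) ℚ.* (q^ e₁ ℚ.* (poch q (n ℕ.+ r) ℚ.* Iₙ ℚ.* Iᵣ) ℚ.* (poch q v ℚ.* Iₙₐ ℚ.* Iₖ))
        ≡⟨ solve 11 (λ y P Iᵥ Iₘ x M Iₙ Iᵣ V Iₙₐ Iₖ →
                       y :* (P :* Iᵥ :* Iₘ) :* (x :* (M :* Iₙ :* Iᵣ) :* (V :* Iₙₐ :* Iₖ))
                    := V :* Iᵥ :* (M :* Iₘ) :* (x :* y :* (P :* Iᵣ :* Iₙ :* Iₙₐ :* Iₖ)))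
                 refl (q^ e₂) (poch q L) Iᵥ Iₘ (q^ e₁) (poch q (n ℕ.+ r)) Iₙ Iᵣ (poch q v) Iₙₐ Iₖ ⟩
      poch q v ℚ.* Iᵥ ℚ.* (poch q (n ℕ.+ r) ℚ.* Iₘ) ℚ.* (q^ e₁ ℚ.* q^ e₂ ℚ.* core)
        ≡⟨ cong₂ (λ x y → x ℚ.* y ℚ.* (q^ e₁ ℚ.* q^ e₂ ℚ.* core)) (poch-*-pochInv v) (poch-*-pochInv (n ℕ.+ r)) ⟩
      1ℚ ℚ.* 1ℚ ℚ.* (q^ e₁ ℚ.* q^ e₂ ℚ.* core)
        ≡⟨ ℚP.*-identityˡ _ ⟩
      q^ e₁ ℚ.* q^ e₂ ℚ.* core ∎
      where
      Iᵥ = pochInv q (+ v)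
      Iₘ = pochInv q (+ (n ℕ.+ r))

  H-term : ℕ → ℤ → ℕ → ℚ
  H-term L a v = q^ ((+ v ℤ.+ + 1) ℤ.* (+ v ℤ.- a)) ℚ.* binom L (+ v) ℚ.* binom L (+ v ℤ.- a)

  binom-trinomial-double-sum : ∀ L a →
    sumTo L (λ i → binom L (+ i) ℚ.* sumTo i (trinomial-term i a)) ≡ sumTo L (H-term L a)
  binom-trinomial-double-sum L a = begin
    sumTo L (λ i → binom L (+ i) ℚ.* sumTo i (trinomial-term i a))
      ≡⟨ sumTo-cong L (λ i → sym (sumTo-*ˡ i (binom L (+ i)) (trinomial-term i a))) ⟩
    sumTo L (λ i → sumTo i (λ n → binom L (+ i) ℚ.* trinomial-term i a n))
      ≡⟨ sumTo-triangle-swap L (λ i n → binom L (+ i) ℚ.* trinomial-term i a n) ⟩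
    sumTo L (λ v → sumTo (L ℕ.∸ v) (λ n → binom L (+ (v ℕ.+ n)) ℚ.* trinomial-term (v ℕ.+ n) a n))
      ≡⟨ sumTo-cong-≤ L (λ v v≤L → trans
           (sumTo-cong-≤ (L ℕ.∸ v) (λ n n≤ →
              binom-*-trinomial-term L (L ℕ.∸ v) v n (L ℕ.∸ v ℕ.∸ n) a (ℕP.m+[n∸m]≡n v≤L) (ℕP.m+[n∸m]≡n n≤)))
           (sumTo-*ˡ (L ℕ.∸ v) (c v ℚ.* binom L (+ v)) (vandermonde-term (L ℕ.∸ v) v a))) ⟩
    sumTo L (λ v → c v ℚ.* binom L (+ v) ℚ.* sumTo (L ℕ.∸ v) (vandermonde-term (L ℕ.∸ v) v a))
      ≡⟨ sumTo-cong-≤ L (λ v v≤L → cong (c v ℚ.* binom L (+ v) ℚ.*_) (inner-sum v v≤L)) ⟩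
    sumTo L (H-term L a) ∎
    where
    c : ℕ → ℚ
    c v = q^ ((+ v ℤ.+ + 1) ℤ.* (+ v ℤ.- a))
    v+m-[m+a] : ∀ v m a → v ℤ.+ m ℤ.- (m ℤ.+ a) ≡ v ℤ.- a
    v+m-[m+a] = solve-∀
    inner-sum : ∀ v → v ≤ L → sumTo (L ℕ.∸ v) (vandermonde-term (L ℕ.∸ v) v a) ≡ binom L (+ v ℤ.- a)
    inner-sum v v≤L = begin
      sumTo (L ℕ.∸ v) (vandermonde-term (L ℕ.∸ v) v a)  ≡⟨ vandermonde v (L ℕ.∸ v) a ⟩
      binom (L ℕ.∸ v ℕ.+ v) (+ (L ℕ.∸ v) ℤ.+ a)         ≡⟨ cong (λ m → binom m (+ (L ℕ.∸ v) ℤ.+ a)) (ℕP.m∸n+n≡m v≤L) ⟩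
      binom L (+ (L ℕ.∸ v) ℤ.+ a)                        ≡⟨ binom-sym L (+ (L ℕ.∸ v) ℤ.+ a) ⟩
      binom L (+ L ℤ.- (+ (L ℕ.∸ v) ℤ.+ a))              ≡⟨ cong (λ m → binom L (+ m ℤ.- (+ (L ℕ.∸ v) ℤ.+ a))) (sym (ℕP.m+[n∸m]≡n v≤L)) ⟩
      binom L (+ (v ℕ.+ (L ℕ.∸ v)) ℤ.- (+ (L ℕ.∸ v) ℤ.+ a)) ≡⟨ cong (binom L) (v+m-[m+a] (+ v) (+ (L ℕ.∸ v)) a) ⟩
      binom L (+ v ℤ.- a)                                ∎

  H-term-pascal : ∀ L a n →
    H-term L a n ℚ.+ q^ (a ℤ.+ + 1) ℚ.* H-term L (a ℤ.+ + 1) n ≡ vandermonde-term L (suc L) (ℤ.- a) n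
  H-term-pascal L a n = sym (begin
    q^ e ℚ.* b ℚ.* binom (suc L) (+ n ℤ.- a)
      ≡⟨ cong (q^ e ℚ.* b ℚ.*_) (pascal-left L (+ n ℤ.- a)) ⟩
    q^ e ℚ.* b ℚ.* (q^ (+ n ℤ.- a) ℚ.* binom L (+ n ℤ.- a) ℚ.+ binom L (+ n ℤ.- a ℤ.- + 1))
      ≡⟨ solve 5 (λ x b y c d → x :* b :* (y :* c :+ d) := x :* y :* b :* c :+ x :* b :* d)
               refl (q^ e) b (q^ (+ n ℤ.- a)) (binom L (+ n ℤ.- a)) (binom L (+ n ℤ.- a ℤ.- + 1)) ⟩
    q^ e ℚ.* q^ (+ n ℤ.- a) ℚ.* b ℚ.* binom L (+ n ℤ.- a) ℚ.+ q^ e ℚ.* b ℚ.* binom L (+ n ℤ.- a ℤ.- + 1)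
      ≡⟨ cong₂ ℚ._+_ (cong (λ x → x ℚ.* b ℚ.* binom L (+ n ℤ.- a))
                          (trans (sym (powZ-+ q≢0 e (+ n ℤ.- a))) (cong q^_ (first-exponent (+ n) a))))
                     (cong₂ (λ x y → x ℚ.* b ℚ.* binom L y)
                          (trans (cong q^_ (second-exponent (+ n) a)) (powZ-+ q≢0 (a ℤ.+ + 1) e′))
                          (third-index (+ n) a)) ⟩
    H-term L a n ℚ.+ q^ (a ℤ.+ + 1) ℚ.* q^ e′ ℚ.* b ℚ.* binom L (+ n ℤ.- (a ℤ.+ + 1))
      ≡⟨ cong (H-term L a n ℚ.+_)
              (solve 4 (λ x y b c → x :* y :* b :* c := x :* (y :* b :* c)) refl (q^ (a ℤ.+ + 1)) (q^ e′) b _) ⟩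
    H-term L a n ℚ.+ q^ (a ℤ.+ + 1) ℚ.* H-term L (a ℤ.+ + 1) n ∎)
    where
    e  = + n ℤ.* (+ n ℤ.- a)
    e′ = (+ n ℤ.+ + 1) ℤ.* (+ n ℤ.- (a ℤ.+ + 1))
    b  = binom L (+ n)
    first-exponent : ∀ n a → n ℤ.* (n ℤ.- a) ℤ.+ (n ℤ.- a) ≡ (n ℤ.+ + 1) ℤ.* (n ℤ.- a)
    first-exponent = solve-∀
    second-exponent : ∀ n a → n ℤ.* (n ℤ.- a) ≡ a ℤ.+ + 1 ℤ.+ (n ℤ.+ + 1) ℤ.* (n ℤ.- (a ℤ.+ + 1))
    second-exponent = solve-∀
    third-index : ∀ n a → n ℤ.- a ℤ.- + 1 ≡ n ℤ.- (a ℤ.+ + 1)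
    third-index = solve-∀

  H-sums-pascal : ∀ L a →
    sumTo L (H-term L a) ℚ.+ q^ (a ℤ.+ + 1) ℚ.* sumTo L (H-term L (a ℤ.+ + 1))
      ≡ binom (L ℕ.+ suc L) (+ L ℤ.- a)
  H-sums-pascal L a = begin
    sumTo L (H-term L a) ℚ.+ q^ (a ℤ.+ + 1) ℚ.* sumTo L (H-term L (a ℤ.+ + 1))
      ≡⟨ cong (sumTo L (H-term L a) ℚ.+_) (sym (sumTo-*ˡ L (q^ (a ℤ.+ + 1)) _)) ⟩
    sumTo L (H-term L a) ℚ.+ sumTo L (λ n → q^ (a ℤ.+ + 1) ℚ.* H-term L (a ℤ.+ + 1) n)
      ≡⟨ sym (sumTo-distrib-+ L _ _) ⟩
    sumTo L (λ n → H-term L a n ℚ.+ q^ (a ℤ.+ + 1) ℚ.* H-term L (a ℤ.+ + 1) n)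
      ≡⟨ sumTo-cong L (H-term-pascal L a) ⟩
    sumTo L (vandermonde-term L (suc L) (ℤ.- a))
      ≡⟨ vandermonde (suc L) L (ℤ.- a) ⟩
    binom (L ℕ.+ suc L) (+ L ℤ.- a) ∎

  weighted-T₋₁-sum : ∀ L a → sumTo L (λ i → q^ (triangle (+ i)) ℚ.* binom L (+ i) ℚ.* T q -1ℤ i a)
                             ≡ q^ (triangle a) ℚ.* sumTo L (H-term L a)
  weighted-T₋₁-sum L a = begin
    sumTo L (λ i → q^ (triangle (+ i)) ℚ.* binom L (+ i) ℚ.* T q -1ℤ i a)
      ≡⟨ sumTo-cong L (λ i → trans (solve 3 (λ x b t → x :* b :* t := b :* (x :* t)) refl (q^ (triangle (+ i))) (binom L (+ i)) (T q -1ℤ i a))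
                                   (cong (binom L (+ i) ℚ.*_) (T₋₁-as-trinomial-sum i a))) ⟩
    sumTo L (λ i → binom L (+ i) ℚ.* (q^ tₐ ℚ.* sumTo i (trinomial-term i a)))
      ≡⟨ sumTo-cong L (λ i → solve 3 (λ b x s → b :* (x :* s) := x :* (b :* s)) refl (binom L (+ i)) (q^ tₐ) (sumTo i (trinomial-term i a))) ⟩
    sumTo L (λ i → q^ tₐ ℚ.* (binom L (+ i) ℚ.* sumTo i (trinomial-term i a)))
      ≡⟨ sumTo-*ˡ L (q^ tₐ) _ ⟩
    q^ tₐ ℚ.* sumTo L (λ i → binom L (+ i) ℚ.* sumTo i (trinomial-term i a))
      ≡⟨ cong (q^ tₐ ℚ.*_) (binom-trinomial-double-sum L a) ⟩
    q^ tₐ ℚ.* sumTo L (H-term L a) ∎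
    where tₐ = triangle a

theorem3p4 : (q : ℚ) → q ≢ 0ℚ → q ≢ 1ℚ → q ≢ ℚ.- 1ℚ → (L : ℕ) (a : ℤ) →
    sumTo L (λ i → powZ q ((+ i ℤ.* (+ i ℤ.+ + 1)) /ℕ 2) ℚ.* qbin q (+ L) (+ i)
                     ℚ.* (T q -1ℤ i a ℚ.+ T q -1ℤ i (a ℤ.+ + 1)))
      ≡ powZ q ((a ℤ.* (a ℤ.+ + 1)) /ℕ 2) ℚ.* qbin q (+ 2 ℤ.* + L ℤ.+ + 1) (+ L ℤ.- a)
theorem3p4 q q≢0 q≢1 q≢-1 L a = begin
  sumTo L (λ i → powZ q ((+ i ℤ.* (+ i ℤ.+ + 1)) /ℕ 2) ℚ.* binom L (+ i) ℚ.* (T q -1ℤ i a ℚ.+ T q -1ℤ i a′))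
    ≡⟨ sumTo-cong L split-summand ⟩
  sumTo L (λ i → W i a ℚ.+ W i a′)
    ≡⟨ sumTo-distrib-+ L _ _ ⟩
  sumTo L (λ i → W i a) ℚ.+ sumTo L (λ i → W i a′)
    ≡⟨ cong₂ ℚ._+_ (weighted-T₋₁-sum L a) (weighted-T₋₁-sum L a′) ⟩
  q^ (triangle a) ℚ.* H a ℚ.+ q^ (triangle a′) ℚ.* H a′
    ≡⟨ cong (λ x → q^ (triangle a) ℚ.* H a ℚ.+ x ℚ.* H a′) (trans (cong q^_ (triangle-suc a)) (powZ-+ q≢0 (triangle a) a′)) ⟩
  q^ (triangle a) ℚ.* H a ℚ.+ q^ (triangle a) ℚ.* q^ a′ ℚ.* H a′
    ≡⟨ solve 4 (λ t h p g → t :* h :+ t :* p :* g := t :* (h :+ p :* g)) refl (q^ (triangle a)) (H a) (q^ a′) (H a′) ⟩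
  q^ (triangle a) ℚ.* (H a ℚ.+ q^ a′ ℚ.* H a′)
    ≡⟨ cong (q^ (triangle a) ℚ.*_) (H-sums-pascal L a) ⟩
  q^ (triangle a) ℚ.* binom (L ℕ.+ suc L) (+ L ℤ.- a)
    ≡⟨ cong₂ (λ e N → powZ q e ℚ.* qbin q N (+ L ℤ.- a)) (sym (triangle-/ℕ2 a)) 2L+1 ⟩
  powZ q ((a ℤ.* (a ℤ.+ + 1)) /ℕ 2) ℚ.* qbin q (+ 2 ℤ.* + L ℤ.+ + 1) (+ L ℤ.- a) ∎
  where
  open Base-q q q≢0 q≢1 q≢-1
  a′ = a ℤ.+ + 1
  W : ℕ → ℤ → ℚ
  W i b = q^ (triangle (+ i)) ℚ.* binom L (+ i) ℚ.* T q -1ℤ i b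
  H : ℤ → ℚ
  H b = sumTo L (H-term L b)
  split-summand : ∀ i → powZ q ((+ i ℤ.* (+ i ℤ.+ + 1)) /ℕ 2) ℚ.* binom L (+ i) ℚ.* (T q -1ℤ i a ℚ.+ T q -1ℤ i a′)
                        ≡ W i a ℚ.+ W i a′
  split-summand i = trans (cong (λ e → powZ q e ℚ.* binom L (+ i) ℚ.* (T q -1ℤ i a ℚ.+ T q -1ℤ i a′)) (triangle-/ℕ2 (+ i)))
                          (ℚP.*-distribˡ-+ (q^ (triangle (+ i)) ℚ.* binom L (+ i)) (T q -1ℤ i a) (T q -1ℤ i a′))
  2L+1 : + (L ℕ.+ suc L) ≡ + 2 ℤ.* + L ℤ.+ + 1
  2L+1 = trans (ℤP.pos-+ L (suc L)) (double (+ L))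
    where
    double : ∀ l → l ℤ.+ (+ 1 ℤ.+ l) ≡ + 2 ℤ.* l ℤ.+ + 1
    double = solve-∀
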